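{- Let $p,q$ be primes with $p\equiv 1\pmod 4$, $q\equiv 3\pmod 4$, $\left(\frac{2}{p}\right)=-1$, $\left(\frac{2}{q}\right)=1$ and $\left(\frac{p}{q}\right)=-1$. 1. Writing $\varepsilon_{pq}=a+b\sqrt{pq}$ with $a,b\in\mathbb{Z}$, $p(a-1)$ is a square in $\mathbb{N}$, and there are integers $b_1,b_2$ with $\sqrt{2\varepsilon_{pq}}=b_1\sqrt{p}+b_2\sqrt{q}$ and $2=-pb_1^2+qb_2^2$. 2. Writing $\varepsilon_{2pq}=x+y\sqrt{2pq}$ with $x,y\in\mathbb{Z}$, $2p(x-1)$ is a square in $\mathbb{N}$, and there are integers $y_1,y_2$ with $\sqrt{2\varepsilon_{2pq}}=y_1\sqrt{2p}+y_2\sqrt{q}$ and $2=-2py_1^2+qy_2^2$. 3. Writing $\varepsilon_{2q}=c+d\sqrt{2q}$ with $c,d\in\mathbb{Z}$, $c+1$ is a square in $\mathbb{N}$, and there are integers $d_1,d_2$ with $\sqrt{2\varepsilon_{2q}}=d_1+d_2\sqrt{2q}$ and $2=d_1^2-2qd_2^2$. 4. Writing $\varepsilon_{q}=c'+d'\sqrt{q}$ with $c',d'\in\mathbb{Z}$, $c'+1$ is a square in $\mathbb{N}$, and there are integers $d_1',d_2'$ with $\sqrt{2\varepsilon_{q}}=d_1'+d_2'\sqrt{q}$ and $2=d_1'^2-qd_2'^2$.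
   Context: For a square-free integer $d>1$, $\varepsilon_d>1$ denotes the fundamental unit of $\mathbb{Q}(\sqrt{d})$. $\left(\frac{\cdot}{\cdot}\right)$ is the Legendre symbol. -}

module Defs where

open import Data.Nat as ℕ using (ℕ)
open import Data.Integer using (ℤ; +_; -[1+_]; _+_; _-_; _*_; -_; _≤_; _<_)
open import Data.Integer.Divisibility using (_∣_)
open import Data.Product using (_×_; ∃-syntax)
open import Data.Sum using (_⊎_)
open import Relation.Binary.PropositionalEquality using (_≡_)
open import Relation.Nullary using (¬_)

sq : ℤ → ℤ
sq x = x * x

LegendreIsOne : ℤ → ℕ → Set
LegendreIsOne a p = ¬ ((+ p) ∣ a) × ∃[ x ] ((+ p) ∣ (sq x - a))

LegendreIsMinusOne : ℤ → ℕ → Set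
LegendreIsMinusOne a p = ¬ ((+ p) ∣ a) × ¬ (∃[ x ] ((+ p) ∣ (sq x - a)))

-- Sign of the real number  u·√m + v·√n  (m n : ℕ positive, u v : ℤ),
-- decided exactly with integer arithmetic.

NonNeg : ℕ → ℕ → ℤ → ℤ → Set
NonNeg m n u v =
    (+ 0 ≤ u × + 0 ≤ v)
  ⊎ (+ 0 ≤ u × v < + 0 × + n * sq v ≤ + m * sq u)
  ⊎ (u < + 0 × + 0 ≤ v × + m * sq u ≤ + n * sq v)

Pos : ℕ → ℕ → ℤ → ℤ → Set
Pos m n u v =
    (+ 0 ≤ u × + 0 ≤ v × ¬ (u ≡ + 0 × v ≡ + 0))
  ⊎ (+ 0 < u × v < + 0 × + n * sq v < + m * sq u)
  ⊎ (u < + 0 × + 0 < v × + m * sq u < + n * sq v)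

-- Units of ℤ[√d] and the fundamental unit.
-- For square-free d ≡ 2,3 (mod 4) (all cases used below), ℤ[√d] is the
-- ring of integers of ℚ(√d), and a + b√d is a unit iff a² - d b² = ±1.

IsUnit : ℕ → ℤ → ℤ → Set
IsUnit d a b = (sq a - + d * sq b ≡ + 1) ⊎ (sq a - + d * sq b ≡ - + 1)

GtOne : ℕ → ℤ → ℤ → Set
GtOne d a b = Pos 1 d (a - + 1) b

IsFundamentalUnit : ℕ → ℤ → ℤ → Set
IsFundamentalUnit d a b =
  IsUnit d a b × GtOne d a b ×
  (∀ a' b' → IsUnit d a' b' → GtOne d a' b' → ¬ Pos 1 d (a - a') (b - b'))

-- "√(2(a + b√(m n))) = u√m + v√n", written out with integers:
-- u√m + v√n ≥ 0 and (u√m + v√n)² = m u² + n v² + 2uv√(mn) equals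
-- 2a + 2b√(mn)  (√(mn) irrational in all uses, so compare coefficients).

SqrtTwoEps : ℕ → ℕ → ℤ → ℤ → ℤ → ℤ → Set
SqrtTwoEps m n a b u v =
  NonNeg m n u v × (+ m * sq u + + n * sq v ≡ + 2 * a) × (u * v ≡ b)

IsSquareℕ : ℤ → Set
IsSquareℕ x = ∃[ k ] (x ≡ + (k ℕ.* k))

-- Write ε = A + S√D with A, S > 0. Since q ∣ D and -1 is not a square modulo q ≡ 3 (mod 4), the norm
-- of ε is 1, so (A + 1)(A - 1) = D S². Its two factors (halved when A is odd) are coprime, hence of the
-- form d₁ u² and d₂ v² with d₁ d₂ = D. Only one distribution of the primes of D survives: the others
-- contradict the quadratic characters of -1, ±2 and p modulo q, of 2 modulo p, or q ≡ 7 (mod 8), and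
-- d₁ = 1 in the odd case would make ε the square of a smaller unit. The surviving one exhibits √(2ε).
-- That -1 is a non-residue modulo primes ≡ 3 (mod 4) and that 2 is a residue only modulo primes
-- ≡ ±1 (mod 8) are proved by Euler's descent.
module Submission where

module Congruence where

  open import Data.Nat
  open import Data.Nat.Properties
  open import Data.Nat.DivMod
  open import Data.Nat.Divisibility
  open import Data.Fin using (Fin; toℕ; fromℕ<)
  open import Data.Fin.Properties using (all?; toℕ-fromℕ<)
  open import Relation.Binary using (IsEquivalence; Setoid)
  open import Relation.Nullary
  open import Relation.Nullary.Decidable using (True; toWitness; map′)
  open import Function using (id)
  open import Data.Sum using (_⊎_; inj₁; inj₂)
  open import Data.Product using (∃-syntax; _,_)
  open import Relation.Binary.PropositionalEquality
  open import Data.Nat.Tactic.RingSolver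
  open import Data.List using (_∷_; [])
  import Relation.Binary.Reasoning.Setoid

  infix 4 _≡_[mod_]

  opaque
    _≡_[mod_] : ℕ → ℕ → (n : ℕ) → .{{NonZero n}} → Set
    _≡_[mod_] x y n = x % n ≡ y % n

  module _ {n : ℕ} .{{_ : NonZero n}} where

    opaque
      unfolding _≡_[mod_]

      %≡%⇒≡-mod : ∀ {a b} → a % n ≡ b % n → a ≡ b [mod n ]
      %≡%⇒≡-mod = id

      ≡-mod⇒%≡% : ∀ {a b} → a ≡ b [mod n ] → a % n ≡ b % n
      ≡-mod⇒%≡% = id

      ≡⇒≡-mod : ∀ {a b} → a ≡ b → a ≡ b [mod n ]
      ≡⇒≡-mod = cong (_% n)

      ≡-mod-isEquivalence : IsEquivalence (λ a b → a ≡ b [mod n ])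
      ≡-mod-isEquivalence = record { refl = refl ; sym = sym ; trans = trans }

      %-≡-mod : ∀ x → x % n ≡ x [mod n ]
      %-≡-mod x = m%n%n≡m%n x n

      +-cong-mod : ∀ {a b c d} → a ≡ b [mod n ] → c ≡ d [mod n ] → a + c ≡ b + d [mod n ]
      +-cong-mod {a} {b} {c} {d} e f = begin
        (a + c) % n             ≡⟨ %-distribˡ-+ a c n ⟩
        (a % n + c % n) % n     ≡⟨ cong₂ (λ x y → (x + y) % n) e f ⟩
        (b % n + d % n) % n     ≡⟨ %-distribˡ-+ b d n ⟨
        (b + d) % n             ∎ where open ≡-Reasoning

      *-cong-mod : ∀ {a b c d} → a ≡ b [mod n ] → c ≡ d [mod n ] → a * c ≡ b * d [mod n ]
      *-cong-mod {a} {b} {c} {d} e f = begin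
        (a * c) % n             ≡⟨ %-distribˡ-* a c n ⟩
        (a % n * (c % n)) % n   ≡⟨ cong₂ (λ x y → (x * y) % n) e f ⟩
        (b % n * (d % n)) % n   ≡⟨ %-distribˡ-* b d n ⟨
        (b * d) % n             ∎ where open ≡-Reasoning

      +-*-mod : ∀ x k → x + k * n ≡ x [mod n ]
      +-*-mod x k = [m+kn]%n≡m%n x k n

      ∣⇒≡0-mod : ∀ {x} → n ∣ x → x ≡ 0 [mod n ]
      ∣⇒≡0-mod (divides k refl) = +-*-mod 0 k

      ≡0-mod⇒∣ : ∀ {x} → x ≡ 0 [mod n ] → n ∣ x
      ≡0-mod⇒∣ {x} x≡0 = m%n≡0⇒n∣m x n (trans x≡0 (0%n≡0 n))
        where
        0%n≡0 : ∀ m .{{_ : NonZero m}} → 0 % m ≡ 0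
        0%n≡0 (suc _) = refl

    _≟-mod_ : ∀ a b → Dec (a ≡ b [mod n ])
    a ≟-mod b = map′ %≡%⇒≡-mod ≡-mod⇒%≡% (a % n ≟ b % n)

    open IsEquivalence ≡-mod-isEquivalence public
      using () renaming (refl to ≡-mod-refl; sym to ≡-mod-sym; trans to ≡-mod-trans)

    +-congˡ-mod : ∀ a {c d} → c ≡ d [mod n ] → a + c ≡ a + d [mod n ]
    +-congˡ-mod a = +-cong-mod (≡-mod-refl {x = a})

    *-congˡ-mod : ∀ a {c d} → c ≡ d [mod n ] → a * c ≡ a * d [mod n ]
    *-congˡ-mod a = *-cong-mod (≡-mod-refl {x = a})

    *-congʳ-mod : ∀ c {a b} → a ≡ b [mod n ] → a * c ≡ b * c [mod n ]
    *-congʳ-mod c a≡b = *-cong-mod a≡b (≡-mod-refl {x = c})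

    ≡-mod-setoid : Setoid _ _
    ≡-mod-setoid = record { isEquivalence = ≡-mod-isEquivalence }

    module ≡-mod-Reasoning = Relation.Binary.Reasoning.Setoid ≡-mod-setoid

    y+r≡n⇒y²≡r² : ∀ {y r} → y + r ≡ n → y * y ≡ r * r [mod n ]
    y+r≡n⇒y²≡r² {y} {r} refl = begin
      y * y                          ≈⟨ +-*-mod (y * y) (2 * r) ⟨
      y * y + 2 * r * (y + r)        ≡⟨ solve (y ∷ r ∷ []) ⟩
      r * r + (y + r) * (y + r)      ≈⟨ +-*-mod (r * r) (y + r) ⟩
      r * r                          ∎ where open ≡-mod-Reasoning

  %4%2 : ∀ x → x % 4 % 2 ≡ x % 2
  %4%2 x = m∣n⇒o%n%m≡o%m 2 4 x (divides 2 refl)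

  %8%4 : ∀ x → x % 8 % 4 ≡ x % 4
  %8%4 x = m∣n⇒o%n%m≡o%m 4 8 x (divides 2 refl)

  %8%2 : ∀ x → x % 8 % 2 ≡ x % 2
  %8%2 x = m∣n⇒o%n%m≡o%m 2 8 x (divides 4 refl)

  residues-mod8 : (P : ℕ → ℕ → ℕ → Set) (P? : ∀ a b c → Dec (P a b c)) →
    {True (all? λ (i : Fin 8) → all? λ (j : Fin 8) → all? λ (k : Fin 8) → P? (toℕ i) (toℕ j) (toℕ k))} →
    ∀ a b c → P (a % 8) (b % 8) (c % 8)
  residues-mod8 P P? {w} a b c = below8 (m%n<n a 8) (m%n<n b 8) (m%n<n c 8)
    where
    below8 : ∀ {i j k} → i < 8 → j < 8 → k < 8 → P i j k
    below8 i< j< k< with toWitness w (fromℕ< i<) (fromℕ< j<) (fromℕ< k<)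
    ... | Pijk rewrite toℕ-fromℕ< i< | toℕ-fromℕ< j< | toℕ-fromℕ< k< = Pijk

  ≡+k*n⇒≡-mod : ∀ {a b} k {n} .{{_ : NonZero n}} → a ≡ b + k * n → a ≡ b [mod n ]
  ≡+k*n⇒≡-mod {b = b} k a≡b+kn = ≡-mod-trans (≡⇒≡-mod a≡b+kn) (+-*-mod b k)

  module _ {n : ℕ} .{{_ : NonZero n}} where

    ∣∸⇒≡-mod : ∀ {x y} → y ≤ x → n ∣ x ∸ y → x ≡ y [mod n ]
    ∣∸⇒≡-mod {x} {y} y≤x (divides k x∸y≡kn) = ≡+k*n⇒≡-mod k (trans (sym (m+[n∸m]≡n y≤x)) (cong (y +_) x∸y≡kn))

    ∣∣-∣⇒≡-mod : ∀ {a b} → n ∣ ∣ a - b ∣ → a ≡ b [mod n ]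
    ∣∣-∣⇒≡-mod {a} {b} n∣∣a-b∣ with ≤-total b a
    ... | inj₁ b≤a = ∣∸⇒≡-mod b≤a (subst (n ∣_) (m≤n⇒∣n-m∣≡n∸m b≤a) n∣∣a-b∣)
    ... | inj₂ a≤b = ≡-mod-sym (∣∸⇒≡-mod a≤b (subst (n ∣_) (m≤n⇒∣m-n∣≡n∸m a≤b) n∣∣a-b∣))

    ≡-mod⇒∣∣-∣ : ∀ {a b} → a ≡ b [mod n ] → n ∣ ∣ a - b ∣
    ≡-mod⇒∣∣-∣ {a} {b} a≡b = divides ∣ a / n - b / n ∣ (begin
      ∣ a - b ∣                                      ≡⟨ cong₂ ∣_-_∣ (m≡m%n+[m/n]*n a n) (m≡m%n+[m/n]*n b n) ⟩
      ∣ a % n + a / n * n - b % n + b / n * n ∣      ≡⟨ cong (λ r → ∣ a % n + a / n * n - r + b / n * n ∣) (≡-mod⇒%≡% a≡b) ⟨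
      ∣ a % n + a / n * n - a % n + b / n * n ∣      ≡⟨ ∣m+n-m+o∣≡∣n-o∣ (a % n) (a / n * n) (b / n * n) ⟩
      ∣ a / n * n - b / n * n ∣                      ≡⟨ *-distribʳ-∣-∣ n (a / n) (b / n) ⟨
      ∣ a / n - b / n ∣ * n                          ∎)
      where open ≡-Reasoning

    <⇒≡-mod⇒≡+k*n : ∀ {a b} → b < n → a ≡ b [mod n ] → a ≡ b + a / n * n
    <⇒≡-mod⇒≡+k*n {a} {b} b<n a≡b =
      trans (m≡m%n+[m/n]*n a n) (cong (_+ a / n * n) (trans (≡-mod⇒%≡% a≡b) (m<n⇒m%n≡m b<n)))

  %2≡0⇒≡2[n/2] : ∀ {n} → n % 2 ≡ 0 → n ≡ 2 * (n / 2)
  %2≡0⇒≡2[n/2] {n} n%2≡0 = trans (m≡m%n+[m/n]*n n 2) (trans (cong (_+ n / 2 * 2) n%2≡0) (*-comm (n / 2) 2))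

  %2≡1⇒≡2[n/2]+1 : ∀ {n} → n % 2 ≡ 1 → n ≡ 2 * (n / 2) + 1
  %2≡1⇒≡2[n/2]+1 {n} n%2≡1 =
    trans (m≡m%n+[m/n]*n n 2) (trans (cong (_+ n / 2 * 2) n%2≡1) (trans (+-comm 1 _) (cong (_+ 1) (*-comm (n / 2) 2))))

  [2k+1]%2≡1 : ∀ k → (2 * k + 1) % 2 ≡ 1
  [2k+1]%2≡1 k = trans (cong (_% 2) (trans (+-comm (2 * k) 1) (cong (1 +_) (*-comm 2 k)))) ([m+kn]%n≡m%n 1 k 2)

  odd⊎double : ∀ n → n % 2 ≡ 1 ⊎ ∃[ k ] n ≡ 2 * k
  odd⊎double n with n % 2 in n%2 | m%n<n n 2
  ... | 0 | _ = inj₂ (n / 2 , %2≡0⇒≡2[n/2] n%2)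
  ... | 1 | _ = inj₁ refl
  ... | suc (suc _) | s≤s (s≤s ())

  ≡n*⇒≡0-mod : ∀ {a n} .{{_ : NonZero n}} m → a ≡ n * m → a ≡ 0 [mod n ]
  ≡n*⇒≡0-mod {n = n} m a≡nm = ≡+k*n⇒≡-mod m (trans a≡nm (*-comm n m))

  [2n]%2≡0 : ∀ n → (2 * n) % 2 ≡ 0
  [2n]%2≡0 n = trans (cong (_% 2) (*-comm 2 n)) (m*n%n≡0 n 2)

  odd*odd : ∀ {m n} → m % 2 ≡ 1 → n % 2 ≡ 1 → (m * n) % 2 ≡ 1
  odd*odd {m} {n} m-odd n-odd = trans (%-distribˡ-* m n 2) (cong₂ (λ a b → (a * b) % 2) m-odd n-odd)

  odd⇒≢0[mod4] : ∀ {n} → n % 2 ≡ 1 → n % 4 ≢ 0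
  odd⇒≢0[mod4] {n} n-odd n≡0 with () ← trans (sym n-odd) (trans (sym (%4%2 n)) (cong (_% 2) n≡0))

  2*odd⇒≢0[mod4] : ∀ {n} → n % 2 ≡ 1 → (2 * n) % 4 ≢ 0
  2*odd⇒≢0[mod4] {n} n-odd 2n≡0 with () ← trans (sym n-odd) (n∣m⇒m%n≡0 n 2 (*-cancelˡ-∣ 2 (m%n≡0⇒n∣m (2 * n) 4 2n≡0)))

  ≡1[mod4]⇒2*≡2[mod8] : ∀ {n} → n % 4 ≡ 1 → (2 * n) % 8 ≡ 2
  ≡1[mod4]⇒2*≡2[mod8] {n} n≡1 = trans (cong (_% 8) 2n≡2+8k) ([m+kn]%n≡m%n 2 (n / 4) 8)
    where
    2n≡2+8k : 2 * n ≡ 2 + n / 4 * 8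
    2n≡2+8k = trans (cong (2 *_) (trans (m≡m%n+[m/n]*n n 4) (cong (_+ n / 4 * 4) n≡1))) (2[1+4k]≡2+8k (n / 4))
      where
      2[1+4k]≡2+8k : ∀ k → 2 * (1 + k * 4) ≡ 2 + k * 8
      2[1+4k]≡2+8k k = solve (k ∷ [])

module Descent where

  open import Data.Nat
  open import Data.Nat.Properties
  open import Data.Nat.DivMod
  open import Data.Nat.Divisibility
  open import Data.Nat.Induction using (<-rec)
  open import Data.Nat.Tactic.RingSolver
  open import Data.List using (_∷_; [])
  open import Data.Product
  open import Data.Sum
  open import Function using (case_of_)
  open import Relation.Nullary.Decidable using (_→-dec_; _⊎-dec_; _×-dec_)
  open import Relation.Binary.PropositionalEquality
  open Congruence

  r<n⇒r²+1<n² : ∀ {r n} → 1 < n → r < n → r * r + 1 < n * n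
  r<n⇒r²+1<n² {r} {suc (suc m)} _ (s≤s r≤1+m) = begin-strict
    r * r + 1                              ≤⟨ +-monoˡ-≤ 1 (*-mono-≤ r≤1+m r≤1+m) ⟩
    suc m * suc m + 1                      <⟨ m<m+n _ (s≤s z≤n) ⟩
    suc m * suc m + 1 + suc (suc (m + m))  ≡⟨ solve (m ∷ []) ⟩
    suc (suc m) * suc (suc m)              ∎ where open ≤-Reasoning
  r<n⇒r²+1<n² {n = 1} (s≤s ()) _

  -- Euler's descent: reduce x modulo n and pass to the odd part of the cofactor k < n.
  ∣x²+1⇒≡1[mod4] : ∀ n → n % 2 ≡ 1 → ∀ x → n ∣ x * x + 1 → n % 4 ≡ 1
  ∣x²+1⇒≡1[mod4] = <-rec _ descend
    where
    descend : ∀ n → (∀ {k} → k < n → k % 2 ≡ 1 → ∀ x → k ∣ x * x + 1 → k % 4 ≡ 1) →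
              n % 2 ≡ 1 → ∀ x → n ∣ x * x + 1 → n % 4 ≡ 1
    descend 1 _ _ _ _ = refl
    descend (suc (suc m)) = step (s≤s (s≤s z≤n))
      where
      step : ∀ {n} → 1 < n → (∀ {k} → k < n → k % 2 ≡ 1 → ∀ x → k ∣ x * x + 1 → k % 4 ≡ 1) →
             n % 2 ≡ 1 → ∀ x → n ∣ x * x + 1 → n % 4 ≡ 1
      step {n} 1<n smaller n-odd x n∣x²+1 = trans (sym (%8%4 n)) (case odd⊎double k of λ where
          (inj₁ k-odd) → from-odd-cofactor k-odd
          (inj₂ (j , k≡2j)) → from-even-cofactor j (trans r²+1≡kn (cong (_* n) k≡2j))
                                                   (≤-<-trans (m≤n*m j 2) (subst (_< n) k≡2j k<n)))
        where
        instance _ = >-nonZero (<-trans z<s 1<n)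
        r : ℕ
        r = x % n
        n∣r²+1 : n ∣ r * r + 1
        n∣r²+1 = ≡0-mod⇒∣ (≡-mod-trans (+-cong-mod (*-cong-mod (%-≡-mod x) (%-≡-mod x)) (≡-mod-refl {x = 1}))
                                      (∣⇒≡0-mod n∣x²+1))
        k : ℕ
        k = quotient n∣r²+1
        r²+1≡kn : r * r + 1 ≡ k * n
        r²+1≡kn = _∣_.equality n∣r²+1
        k<n : k < n
        k<n = *-cancelʳ-< n k n (subst (_< n * n) r²+1≡kn (r<n⇒r²+1<n² 1<n (m%n<n x n)))
        n%8-odd : n % 8 % 2 ≡ 1
        n%8-odd = trans (%8%2 n) n-odd
        r²+1-residue : (r % 8) * (r % 8) + 1 ≡ r * r + 1 [mod 8 ]
        r²+1-residue = +-cong-mod (*-cong-mod (%-≡-mod r) (%-≡-mod r)) (≡-mod-refl {x = 1})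

        from-odd-cofactor : k % 2 ≡ 1 → n % 8 % 4 ≡ 1
        from-odd-cofactor k-odd =
          residues-mod8 (λ a b c → a * a + 1 ≡ b * c [mod 8 ] → c % 2 ≡ 1 → b % 4 ≡ 1 → c % 4 ≡ 1)
                        (λ a b c → ((a * a + 1) ≟-mod (b * c)) →-dec ((c % 2 ≟ 1) →-dec ((b % 4 ≟ 1) →-dec (c % 4 ≟ 1))))
                        r k n residues n%8-odd
                        (trans (%8%4 k) (smaller k<n k-odd r (divides n (trans r²+1≡kn (*-comm k n)))))
          where
          residues : (r % 8) * (r % 8) + 1 ≡ (k % 8) * (n % 8) [mod 8 ]
          residues = begin
            (r % 8) * (r % 8) + 1  ≈⟨ r²+1-residue ⟩
            r * r + 1              ≡⟨ r²+1≡kn ⟩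
            k * n                  ≈⟨ *-cong-mod (%-≡-mod k) (%-≡-mod n) ⟨
            (k % 8) * (n % 8)      ∎ where open ≡-mod-Reasoning

        from-even-cofactor : ∀ j → r * r + 1 ≡ 2 * j * n → j < n → n % 8 % 4 ≡ 1
        from-even-cofactor j r²+1≡2jn j<n =
          j≡1⇒n≡1 (trans (%8%4 j) (smaller j<n (trans (sym (%8%2 j)) j-odd) r (divides (2 * n) (trans r²+1≡2jn (solve (j ∷ n ∷ []))))))
          where
          residues : (r % 8) * (r % 8) + 1 ≡ 2 * (j % 8) * (n % 8) [mod 8 ]
          residues = begin
            (r % 8) * (r % 8) + 1  ≈⟨ r²+1-residue ⟩
            r * r + 1              ≡⟨ r²+1≡2jn ⟩
            2 * j * n              ≈⟨ *-cong-mod (*-congˡ-mod 2 (%-≡-mod j)) (%-≡-mod n) ⟨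
            2 * (j % 8) * (n % 8)  ∎ where open ≡-mod-Reasoning
          j-odd,j≡1⇒n≡1 : j % 8 % 2 ≡ 1 × (j % 8 % 4 ≡ 1 → n % 8 % 4 ≡ 1)
          j-odd,j≡1⇒n≡1 = residues-mod8
            (λ a b c → a * a + 1 ≡ 2 * b * c [mod 8 ] → c % 2 ≡ 1 → b % 2 ≡ 1 × (b % 4 ≡ 1 → c % 4 ≡ 1))
            (λ a b c → ((a * a + 1) ≟-mod (2 * b * c)) →-dec ((c % 2 ≟ 1) →-dec ((b % 2 ≟ 1) ×-dec ((b % 4 ≟ 1) →-dec (c % 4 ≟ 1)))))
            r j n residues n%8-odd
          j-odd : j % 8 % 2 ≡ 1
          j-odd = proj₁ j-odd,j≡1⇒n≡1
          j≡1⇒n≡1 : j % 8 % 4 ≡ 1 → n % 8 % 4 ≡ 1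
          j≡1⇒n≡1 = proj₂ j-odd,j≡1⇒n≡1

  ∣x²∸2⇒≡±1[mod8] : ∀ n → n % 2 ≡ 1 → ∀ x k → x * x ≡ 2 + k * n → n % 8 ≡ 1 ⊎ n % 8 ≡ 7
  ∣x²∸2⇒≡±1[mod8] = <-rec _ descend
    where
    descend : ∀ n → (∀ {K} → K < n → K % 2 ≡ 1 → ∀ x k → x * x ≡ 2 + k * K → K % 8 ≡ 1 ⊎ K % 8 ≡ 7) →
              n % 2 ≡ 1 → ∀ x k → x * x ≡ 2 + k * n → n % 8 ≡ 1 ⊎ n % 8 ≡ 7
    descend 1 _ _ _ _ _ = inj₁ refl
    descend (suc (suc (suc m))) = step (s≤s (s≤s (s≤s z≤n)))
      where
      step : ∀ {n} → 2 < n → (∀ {K} → K < n → K % 2 ≡ 1 → ∀ x k → x * x ≡ 2 + k * K → K % 8 ≡ 1 ⊎ K % 8 ≡ 7) →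
             n % 2 ≡ 1 → ∀ x k → x * x ≡ 2 + k * n → n % 8 ≡ 1 ⊎ n % 8 ≡ 7
      step {n} 2<n smaller n-odd x k x²≡2+kn = descend-from odd-root
        where
        instance _ = >-nonZero (<-trans z<s 2<n)
        r : ℕ
        r = x % n
        r²≡2 : r * r ≡ 2 [mod n ]
        r²≡2 = ≡-mod-trans (*-cong-mod (%-≡-mod x) (%-≡-mod x)) (≡-mod-trans (≡⇒≡-mod x²≡2+kn) (+-*-mod 2 k))
        odd-complement : ∀ {y j} → y + 2 * j ≡ n → y % 2 ≡ 1
        odd-complement {y} {j} e = trans (sym ([m+kn]%n≡m%n y j 2)) (trans (cong (_% 2) (trans (cong (y +_) (*-comm j 2)) e)) n-odd)
        -- of the two square roots r and n ∸ r of 2, one is odd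
        odd-root : ∃[ y ] y ≤ n × y % 2 ≡ 1 × (y * y ≡ 2 [mod n ])
        odd-root = case odd⊎double r of λ where
          (inj₁ r-odd) → r , <⇒≤ (m%n<n x n) , r-odd , r²≡2
          (inj₂ (j , r≡2j)) →
            let y+r≡n = m∸n+n≡m (<⇒≤ (m%n<n x n))
            in n ∸ r , m∸n≤m n r , odd-complement {n ∸ r} {j} (trans (cong (n ∸ r +_) (sym r≡2j)) y+r≡n) ,
               ≡-mod-trans (y+r≡n⇒y²≡r² {y = n ∸ r} {r} y+r≡n) r²≡2
        descend-from : ∃[ y ] y ≤ n × y % 2 ≡ 1 × (y * y ≡ 2 [mod n ]) → n % 8 ≡ 1 ⊎ n % 8 ≡ 7
        descend-from (y , y≤n , y-odd , y²≡2) = K±1⇒n±1 (smaller K<n (trans (sym (%8%2 K)) K-odd) y n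
                                                   (trans y²≡2+Kn (cong (2 +_) (*-comm K n))))
          where
          K : ℕ
          K = y * y / n
          y²≡2+Kn : y * y ≡ 2 + K * n
          y²≡2+Kn = <⇒≡-mod⇒≡+k*n 2<n y²≡2
          K<n : K < n
          K<n = *-cancelʳ-< n K n (<-≤-trans (m<n+m (K * n) z<s) (subst (_≤ n * n) y²≡2+Kn (*-mono-≤ y≤n y≤n)))
          residues : (y % 8) * (y % 8) ≡ 2 + (K % 8) * (n % 8) [mod 8 ]
          residues = begin
            (y % 8) * (y % 8)      ≈⟨ *-cong-mod (%-≡-mod y) (%-≡-mod y) ⟩
            y * y                  ≡⟨ y²≡2+Kn ⟩
            2 + K * n              ≈⟨ +-congˡ-mod 2 (*-cong-mod (%-≡-mod K) (%-≡-mod n)) ⟨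
            2 + (K % 8) * (n % 8)  ∎ where open ≡-mod-Reasoning
          K-odd,K±1⇒n±1 : K % 8 % 2 ≡ 1 × ((K % 8 ≡ 1 ⊎ K % 8 ≡ 7) → n % 8 ≡ 1 ⊎ n % 8 ≡ 7)
          K-odd,K±1⇒n±1 = residues-mod8
            (λ a b c → a * a ≡ 2 + b * c [mod 8 ] → a % 2 ≡ 1 → c % 2 ≡ 1 → b % 2 ≡ 1 × ((b ≡ 1 ⊎ b ≡ 7) → c ≡ 1 ⊎ c ≡ 7))
            (λ a b c → ((a * a) ≟-mod (2 + b * c)) →-dec ((a % 2 ≟ 1) →-dec ((c % 2 ≟ 1) →-dec
                       ((b % 2 ≟ 1) ×-dec (((b ≟ 1) ⊎-dec (b ≟ 7)) →-dec ((c ≟ 1) ⊎-dec (c ≟ 7)))))))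
            y K n residues (trans (%8%2 y) y-odd) (trans (%8%2 n) n-odd)
          K-odd : K % 8 % 2 ≡ 1
          K-odd = proj₁ K-odd,K±1⇒n±1
          K±1⇒n±1 : K % 8 ≡ 1 ⊎ K % 8 ≡ 7 → n % 8 ≡ 1 ⊎ n % 8 ≡ 7
          K±1⇒n±1 = proj₂ K-odd,K±1⇒n±1

module QuadraticResidues where

  open import Data.Nat
  open import Data.Nat.Properties
  open import Data.Nat.Divisibility
  open import Data.Nat.Coprimality using (Coprime; coprime-Bézout)
  open import Data.Nat.GCD using (module Bézout)
  open import Data.Nat.Primality using (Prime; prime⇒irreducible)
  open import Relation.Nullary.Decidable using (_→-dec_; _⊎-dec_)
  open import Data.Nat.Tactic.RingSolver
  open import Data.List using (_∷_; [])
  open import Data.Product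
  open import Data.Sum
  import Data.Sum
  open import Data.Empty
  open import Relation.Nullary
  open import Relation.Binary.PropositionalEquality
  open Congruence
  open Descent

  prime∤⇒coprime : ∀ {p n} → Prime p → ¬ p ∣ n → Coprime p n
  prime∤⇒coprime p-prime p∤n (d∣p , d∣n) with prime⇒irreducible p-prime d∣p
  ... | inj₁ d≡1 = d≡1
  ... | inj₂ refl = ⊥-elim (p∤n d∣n)

  square-of-pred-multiple : ∀ u a q → 1 + u ≡ a * q → u * u + 2 * a * q ≡ 1 + a * a * q * q
  square-of-pred-multiple u a q 1+u≡aq = begin
    u * u + 2 * a * q      ≡⟨ solve (u ∷ a ∷ q ∷ []) ⟩
    u * u + 2 * (a * q)    ≡⟨ cong (λ z → u * u + 2 * z) 1+u≡aq ⟨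
    u * u + 2 * (1 + u)    ≡⟨ solve (u ∷ []) ⟩
    1 + (1 + u) * (1 + u)  ≡⟨ cong (λ z → 1 + z * z) 1+u≡aq ⟩
    1 + (a * q) * (a * q)  ≡⟨ solve (a ∷ q ∷ []) ⟩
    1 + a * a * q * q      ∎ where open ≡-Reasoning

  module _ {q : ℕ} .{{_ : NonZero q}} where

    -- Whatever the sign in Bézout's identity 1 ± b t ≡ 0, the square (b t)² is 1.
    inverse-of-square : ∀ {t} → Coprime q t → ∃[ b ] (b * t) * (b * t) ≡ 1 [mod q ]
    inverse-of-square {t} q⊥t with coprime-Bézout q⊥t
    ... | Bézout.-+ a b 1+aq≡bt = b , *-cong-mod bt≡1 bt≡1
      where
      bt≡1 : b * t ≡ 1 [mod q ]
      bt≡1 = ≡+k*n⇒≡-mod a (sym 1+aq≡bt)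
    ... | Bézout.+- a b 1+bt≡aq =
      b , ≡-mod-trans (≡-mod-sym (+-*-mod (b * t * (b * t)) (2 * a)))
                      (≡+k*n⇒≡-mod (a * a * q) (square-of-pred-multiple (b * t) a q 1+bt≡aq))

    residue-of-quotient : ∀ {a t s} → Coprime q t → a * (t * t) ≡ s * s [mod q ] → ∃[ x ] x * x ≡ a [mod q ]
    residue-of-quotient {a} {t} {s} q⊥t at²≡s² with inverse-of-square q⊥t
    ... | b , [bt]²≡1 = s * b , (begin
        s * b * (s * b)         ≡⟨ solve (s ∷ b ∷ []) ⟩
        s * s * (b * b)         ≈⟨ *-congʳ-mod (b * b) at²≡s² ⟨
        a * (t * t) * (b * b)   ≡⟨ solve (a ∷ t ∷ b ∷ []) ⟩
        a * (b * t * (b * t))   ≈⟨ *-congˡ-mod a [bt]²≡1 ⟩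
        a * 1                   ≡⟨ *-identityʳ a ⟩
        a                       ∎)
      where open ≡-mod-Reasoning

    sum-of-squares⇒-1-residue : ∀ {x y} → Coprime q y → x * x + y * y ≡ 0 [mod q ] → ∃[ z ] z * z + 1 ≡ 0 [mod q ]
    sum-of-squares⇒-1-residue {x} {y} q⊥y x²+y²≡0 with inverse-of-square q⊥y
    ... | b , [by]²≡1 = b * x , (begin
        b * x * (b * x) + 1                ≈⟨ +-congˡ-mod (b * x * (b * x)) [by]²≡1 ⟨
        b * x * (b * x) + b * y * (b * y)  ≡⟨ solve (b ∷ x ∷ y ∷ []) ⟩
        b * b * (x * x + y * y)            ≈⟨ *-congˡ-mod (b * b) x²+y²≡0 ⟩
        b * b * 0                          ≡⟨ *-zeroʳ (b * b) ⟩
        0                                  ∎)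
      where open ≡-mod-Reasoning

  module _ {q : ℕ} .{{_ : NonZero q}} (q-prime : Prime q) where

    non-residue*square≢residue : ∀ {a c} → (∀ x → ¬ x * x ≡ a [mod q ]) → ¬ q ∣ c → ∀ s → s * s ≡ c [mod q ] →
                                 ∀ x → ¬ a * (x * x) ≡ c [mod q ]
    non-residue*square≢residue {a} {c} a-non-residue q∤c s s²≡c x ax²≡c =
      let y , y²≡a = residue-of-quotient {a = a} {t = x} {s = s} (prime∤⇒coprime q-prime q∤x) (≡-mod-trans ax²≡c (≡-mod-sym s²≡c))
      in a-non-residue y y²≡a
      where
      q∤x : ¬ q ∣ x
      q∤x q∣x = q∤c (≡0-mod⇒∣ (≡-mod-trans (≡-mod-sym ax²≡c) (∣⇒≡0-mod (∣n⇒∣m*n a (∣m⇒∣m*n x q∣x)))))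

  module PrimeThreeModFour {q : ℕ} .{{_ : NonZero q}} (q-prime : Prime q) (q≡3[mod4] : q % 4 ≡ 3)
                           (w : ℕ) (w²≡2 : w * w ≡ 2 [mod q ]) where

    q-odd : q % 2 ≡ 1
    q-odd = trans (sym (%4%2 q)) (cong (_% 2) q≡3[mod4])

    2<q : 2 < q
    2<q = ≡3[mod4]⇒2< q≡3[mod4]
      where
      ≡3[mod4]⇒2< : ∀ {n} → n % 4 ≡ 3 → 2 < n
      ≡3[mod4]⇒2< {suc (suc (suc _))} _ = s≤s (s≤s (s≤s z≤n))

    q∤1 : ¬ q ∣ 1
    q∤1 q∣1 = <⇒≱ (≤-trans (n≤1+n 2) 2<q) (∣⇒≤ q∣1)

    q∤2 : ¬ q ∣ 2
    q∤2 q∣2 = <⇒≱ 2<q (∣⇒≤ q∣2)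

    -1-non-residue : ∀ x → ¬ x * x + 1 ≡ 0 [mod q ]
    -1-non-residue x x²+1≡0 with trans (sym (∣x²+1⇒≡1[mod4] q q-odd x (≡0-mod⇒∣ x²+1≡0))) q≡3[mod4]
    ... | ()

    -2-non-residue : ∀ x → ¬ x * x + 2 ≡ 0 [mod q ]
    -2-non-residue x x²+2≡0 =
      let z , z²+1≡0 = sum-of-squares⇒-1-residue {x = x} (prime∤⇒coprime q-prime q∤w)
                                                  (≡-mod-trans (+-congˡ-mod (x * x) w²≡2) x²+2≡0)
      in -1-non-residue z z²+1≡0
      where
      q∤w : ¬ q ∣ w
      q∤w q∣w = q∤2 (≡0-mod⇒∣ (≡-mod-trans (≡-mod-sym w²≡2) (∣⇒≡0-mod (∣m⇒∣m*n w q∣w))))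

    q≡7[mod8] : q % 8 ≡ 7
    q≡7[mod8] with ∣x²∸2⇒≡±1[mod8] q q-odd w (w * w / q) (<⇒≡-mod⇒≡+k*n 2<q w²≡2)
    ... | inj₂ q≡7 = q≡7
    ... | inj₁ q≡1 with trans (sym (trans (sym (%8%4 q)) (cong (_% 4) q≡1))) q≡3[mod4]
    ...   | ()

    q*square≢1+P*square : ∀ {P} → P % 4 ≡ 1 ⊎ P % 8 ≡ 2 → ∀ u v → q * (u * u) ≢ 1 + P * (v * v)
    q*square≢1+P*square {P} P≡1∨2 u v qu²≡1+Pv² = residues-mod8
        (λ a b c → 7 * (a * a) ≡ 1 + c * (b * b) [mod 8 ] → c % 4 ≡ 1 ⊎ c ≡ 2 → ⊥)
        (λ a b c → ((7 * (a * a)) ≟-mod (1 + c * (b * b))) →-dec (((c % 4 ≟ 1) ⊎-dec (c ≟ 2)) →-dec no λ ()))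
        u v P residues (Data.Sum.map₁ (trans (%8%4 P)) P≡1∨2)
      where
      residues : 7 * ((u % 8) * (u % 8)) ≡ 1 + (P % 8) * ((v % 8) * (v % 8)) [mod 8 ]
      residues = begin
        7 * ((u % 8) * (u % 8))            ≡⟨ cong (_* ((u % 8) * (u % 8))) q≡7[mod8] ⟨
        q % 8 * ((u % 8) * (u % 8))        ≈⟨ *-cong-mod (%-≡-mod q) (*-cong-mod (%-≡-mod u) (%-≡-mod u)) ⟩
        q * (u * u)                        ≡⟨ qu²≡1+Pv² ⟩
        1 + P * (v * v)                    ≈⟨ +-congˡ-mod 1 (*-cong-mod (%-≡-mod P) (*-cong-mod (%-≡-mod v) (%-≡-mod v))) ⟨
        1 + (P % 8) * ((v % 8) * (v % 8))  ∎
        where open ≡-mod-Reasoning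

    module _ {p} (p-non-residue : ∀ x → ¬ x * x ≡ p [mod q ]) where

      p*square≢1 : ∀ x → ¬ p * (x * x) ≡ 1 [mod q ]
      p*square≢1 = non-residue*square≢residue q-prime p-non-residue q∤1 1 ≡-mod-refl

      p*square≢2 : ∀ x → ¬ p * (x * x) ≡ 2 [mod q ]
      p*square≢2 = non-residue*square≢residue q-prime p-non-residue q∤2 w w²≡2

    q∣D⇒norm≢-1 : ∀ {D} → q ∣ D → ∀ A X → A * A + 1 ≢ D * X
    q∣D⇒norm≢-1 (divides E refl) A X A²+1≡EqX =
      -1-non-residue A (≡n*⇒≡0-mod (E * X) (trans A²+1≡EqX (solve (E ∷ q ∷ X ∷ []))))

module Legendre where

  open import Data.Nat as ℕ using (ℕ; NonZero; ∣_-_∣)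
  open import Data.Nat.Properties using (≤-total; m≤n⇒∣n-m∣≡n∸m; m≤n⇒∣m-n∣≡n∸m)
  open import Data.Nat.Divisibility using (_∣_)
  open import Data.Integer as ℤ using (ℤ; +_; -[1+_])
  open import Data.Integer.Properties using (pos-*; m-n≡m⊖n; ⊖-≥; ∣⊖∣-≤)
  open import Data.Product
  open import Data.Sum
  open import Relation.Nullary
  open import Relation.Binary.PropositionalEquality
  open import Defs using (sq; LegendreIsOne; LegendreIsMinusOne)
  open Congruence

  sq≡+∣∣*∣∣ : ∀ x → sq x ≡ + (ℤ.∣ x ∣ ℕ.* ℤ.∣ x ∣)
  sq≡+∣∣*∣∣ (+ n) = sym (pos-* n n)
  sq≡+∣∣*∣∣ -[1+ n ] = refl

  ∣+a-+b∣≡∣a-b∣ : ∀ a b → ℤ.∣ + a ℤ.- + b ∣ ≡ ∣ a - b ∣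
  ∣+a-+b∣≡∣a-b∣ a b with ≤-total b a
  ... | inj₁ b≤a = trans (cong ℤ.∣_∣ (trans (m-n≡m⊖n a b) (⊖-≥ b≤a))) (sym (m≤n⇒∣n-m∣≡n∸m b≤a))
  ... | inj₂ a≤b = trans (cong ℤ.∣_∣ (m-n≡m⊖n a b)) (trans (∣⊖∣-≤ a≤b) (sym (m≤n⇒∣m-n∣≡n∸m a≤b)))

  module _ {a q : ℕ} .{{_ : NonZero q}} where

    ∣sq-a∣≡∣x²-a∣ : ∀ x → ℤ.∣ sq x ℤ.- + a ∣ ≡ ∣ ℤ.∣ x ∣ ℕ.* ℤ.∣ x ∣ - a ∣
    ∣sq-a∣≡∣x²-a∣ x = trans (cong (λ s → ℤ.∣ s ℤ.- + a ∣) (sq≡+∣∣*∣∣ x)) (∣+a-+b∣≡∣a-b∣ _ a)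

    LegendreIsOne⇒residue : LegendreIsOne (+ a) q → ∃[ x ] x ℕ.* x ≡ a [mod q ]
    LegendreIsOne⇒residue (_ , x , q∣x²-a) = ℤ.∣ x ∣ , ∣∣-∣⇒≡-mod (subst (q ∣_) (∣sq-a∣≡∣x²-a∣ x) q∣x²-a)

    LegendreIsMinusOne⇒non-residue : LegendreIsMinusOne (+ a) q → ∀ x → ¬ x ℕ.* x ≡ a [mod q ]
    LegendreIsMinusOne⇒non-residue (_ , no-root) x x²≡a =
      no-root (+ x , subst (q ∣_) (sym (∣sq-a∣≡∣x²-a∣ (+ x))) (≡-mod⇒∣∣-∣ x²≡a))

module NormEquation where

  open import Data.Nat
  open import Data.Nat.Properties
  open import Data.Nat.Coprimality using (Coprime; coprime-+; 1-coprimeTo)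
  open import Data.Nat.Primality using (prime[2])
  open import Data.Nat.Divisibility using (_∣_; n∣m⇒m%n≡0)
  open import Data.Nat.DivMod
  open import Data.Nat.Tactic.RingSolver
  open import Data.List using (_∷_; [])
  open import Data.Product
  open import Data.Sum
  open import Data.Empty
  open import Function using (case_of_)
  open import Relation.Nullary
  open import Relation.Nullary.Decidable using (_→-dec_; ¬?)
  open import Relation.Binary.PropositionalEquality
  open Congruence
  open QuadraticResidues using (prime∤⇒coprime)

  square-residue : ∀ a → (a % 8) * (a % 8) ≡ a * a [mod 8 ]
  square-residue a = *-cong-mod (%-≡-mod a) (%-≡-mod a)

  consecutive-halves : ∀ {y z D} → (2 * y + 1) * (2 * y + 1) ≡ 1 + D * (2 * z * (2 * z)) → (y + 1) * y ≡ D * (z * z)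
  consecutive-halves {y} {z} {D} e = *-cancelˡ-≡ _ _ 4 (+-cancelˡ-≡ 1 _ _ (begin
    1 + 4 * ((y + 1) * y)         ≡⟨ solve (y ∷ []) ⟩
    (2 * y + 1) * (2 * y + 1)     ≡⟨ e ⟩
    1 + D * (2 * z * (2 * z))     ≡⟨ solve (D ∷ z ∷ []) ⟩
    1 + 4 * (D * (z * z))         ∎))
    where open ≡-Reasoning

  module _ {A D S : ℕ} (A²≡1+DS² : A * A ≡ 1 + D * (S * S)) where

    norm-equation-residues : (A % 8) * (A % 8) ≡ 1 + (D % 8) * ((S % 8) * (S % 8)) [mod 8 ]
    norm-equation-residues = begin
      (A % 8) * (A % 8)                  ≈⟨ square-residue A ⟩
      A * A                              ≡⟨ A²≡1+DS² ⟩
      1 + D * (S * S)                    ≈⟨ +-congˡ-mod 1 (*-cong-mod (%-≡-mod D) (square-residue S)) ⟨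
      1 + (D % 8) * ((S % 8) * (S % 8))  ∎
      where open ≡-mod-Reasoning

    even-D⇒odd-A : D % 2 ≡ 0 → A % 2 ≡ 1
    even-D⇒odd-A D-even = trans (sym (%8%2 A)) (residues-mod8
      (λ a s d → a * a ≡ 1 + d * (s * s) [mod 8 ] → d % 2 ≡ 0 → a % 2 ≡ 1)
      (λ a s d → ((a * a) ≟-mod (1 + d * (s * s))) →-dec ((d % 2 ≟ 0) →-dec (a % 2 ≟ 1)))
      A S D norm-equation-residues (trans (%8%2 D) D-even))

    odd-A⇒even-S : A % 2 ≡ 1 → ¬ D % 4 ≡ 0 → S % 2 ≡ 0
    odd-A⇒even-S A-odd D≢0[mod4] = trans (sym (%8%2 S)) (residues-mod8
      (λ a s d → a * a ≡ 1 + d * (s * s) [mod 8 ] → a % 2 ≡ 1 → ¬ d % 4 ≡ 0 → s % 2 ≡ 0)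
      (λ a s d → ((a * a) ≟-mod (1 + d * (s * s))) →-dec ((a % 2 ≟ 1) →-dec (¬? (d % 4 ≟ 0) →-dec (s % 2 ≟ 0))))
      A S D norm-equation-residues (trans (%8%2 A) A-odd) (λ D%8≡0 → D≢0[mod4] (trans (sym (%8%4 D)) D%8≡0)))

    halve-odd-A : A % 2 ≡ 1 → ¬ D % 4 ≡ 0 →
                  ∃₂ λ y z → A ≡ 2 * y + 1 × S ≡ 2 * z × Coprime (y + 1) y × (y + 1) * y ≡ D * (z * z)
    halve-odd-A A-odd D≢0[mod4] =
      A / 2 , S / 2 , A≡2y+1 , S≡2z , coprime-+ (1-coprimeTo (A / 2)) ,
      consecutive-halves {A / 2} {S / 2} {D} (subst₂ (λ a s → a * a ≡ 1 + D * (s * s)) A≡2y+1 S≡2z A²≡1+DS²)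
      where
      A≡2y+1 : A ≡ 2 * (A / 2) + 1
      A≡2y+1 = %2≡1⇒≡2[n/2]+1 A-odd
      S≡2z : S ≡ 2 * (S / 2)
      S≡2z = %2≡0⇒≡2[n/2] (odd-A⇒even-S A-odd D≢0[mod4])

    halve-even-A : ∀ {j} → A ≡ 2 * j → ∃[ y ] A ≡ y + 1 × Coprime (y + 2) y × (y + 2) * y ≡ D * (S * S)
    halve-even-A {zero} A≡0 = case trans (sym (cong (λ a → a * a) A≡0)) A²≡1+DS² of λ ()
    halve-even-A {suc i} A≡2[1+i] = 2 * i + 1 , A≡y+1 , coprime-+ (prime∤⇒coprime prime[2] 2∤y) ,
      +-cancelˡ-≡ 1 _ _ (begin
        1 + (2 * i + 1 + 2) * (2 * i + 1)   ≡⟨ solve (i ∷ []) ⟩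
        (2 * i + 1 + 1) * (2 * i + 1 + 1)   ≡⟨ cong (λ a → a * a) A≡y+1 ⟨
        A * A                               ≡⟨ A²≡1+DS² ⟩
        1 + D * (S * S)                     ∎)
      where
      open ≡-Reasoning
      A≡y+1 : A ≡ 2 * i + 1 + 1
      A≡y+1 = trans A≡2[1+i] (solve (i ∷ []))
      2∤y : ¬ 2 ∣ 2 * i + 1
      2∤y 2∣y with () ← trans (sym (n∣m⇒m%n≡0 _ 2 2∣y)) ([2k+1]%2≡1 i)


  Norm± : ℕ → ℕ → Set
  Norm± α X = α * α ≡ 1 + X ⊎ α * α + 1 ≡ X

  -- ε = A + S√D is not the square of a unit u + v√D of norm 1
  NotSquare : ℕ → ℕ → ℕ → Set
  NotSquare D A S = ∀ u v → u * u ≡ 1 + D * (v * v) → A ≡ u * u + D * (v * v) → S ≡ 2 * (u * v) → ⊥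

  -- √(2ε) = U + V√n for ε = A + S√n
  record Sqrt2ε₁ (n A S : ℕ) : Set where
    constructor sqrt2ε₁
    field
      U V : ℕ
      A+1≡U² : A + 1 ≡ U * U
      A≡nV²+1 : A ≡ n * (V * V) + 1
      UV≡S : U * V ≡ S

  -- √(2ε) = V√m + U√n for ε = A + S√(mn)
  record Sqrt2ε₂ (m n A S : ℕ) : Set where
    constructor sqrt2ε₂
    field
      U V : ℕ
      A≡mV²+1 : A ≡ m * (V * V) + 1
      A+1≡nU² : A + 1 ≡ n * (U * U)
      VU≡S : V * U ≡ S

  not-square-leaf : ∀ {D A S y z u v} → NotSquare D A S → A ≡ 2 * y + 1 → S ≡ 2 * z →
                    y + 1 ≡ u * u → y ≡ D * (v * v) → u * v ≡ z → ⊥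
  not-square-leaf {D} {u = u} {v} not-square refl refl Dv²+1≡u² refl refl =
    not-square u v (trans (sym Dv²+1≡u²) (+-comm _ 1)) (begin
      2 * (D * (v * v)) + 1          ≡⟨ solve (D ∷ v ∷ []) ⟩
      D * (v * v) + 1 + D * (v * v)  ≡⟨ cong (_+ D * (v * v)) Dv²+1≡u² ⟩
      u * u + D * (v * v)            ∎) refl
    where open ≡-Reasoning

module FundamentalUnits where

  open import Data.Nat as ℕ using (ℕ; zero; suc; z≤n; s≤s)
  import Data.Nat.Properties as ℕ
  open import Data.Integer as ℤ using (ℤ; +_; -[1+_]; _+_; _-_; _*_; -_; +≤+; +<+)
  open import Data.Integer.Properties using (+-injective; pos-*; pos-+; m-n≡m⊖n; ⊖-≥; drop‿+<+; *-identityˡ; +-comm)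
  open import Data.Integer.Tactic.RingSolver using (solve-∀)
  open import Data.Nat.Tactic.RingSolver using (solve)
  open import Data.List using (_∷_; [])
  open import Data.Product
  open import Data.Sum
  open import Data.Empty
  open import Relation.Nullary
  open import Relation.Binary.PropositionalEquality
  open import Defs
  open Legendre using (sq≡+∣∣*∣∣)
  open NormEquation using (Norm±; NotSquare; Sqrt2ε₁; Sqrt2ε₂; sqrt2ε₁; sqrt2ε₂)

  +D*sq≡ : ∀ D b → + D * sq b ≡ + (D ℕ.* (ℤ.∣ b ∣ ℕ.* ℤ.∣ b ∣))
  +D*sq≡ D b = trans (cong (+ D *_) (sq≡+∣∣*∣∣ b)) (sym (pos-* D _))

  +m-+n≡+ : ∀ {m n} → n ℕ.≤ m → + m - + n ≡ + (m ℕ.∸ n)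
  +m-+n≡+ {m} {n} n≤m = trans (m-n≡m⊖n m n) (⊖-≥ n≤m)

  +m-+n≡+k⇒m≡k+n : ∀ {m n k} → + m - + n ≡ + k → m ≡ k ℕ.+ n
  +m-+n≡+k⇒m≡k+n {m} {n} {k} e = +-injective (begin
    + m                  ≡⟨ x≡[x-y]+y (+ m) (+ n) ⟩
    (+ m - + n) + + n    ≡⟨ cong (_+ + n) e ⟩
    + k + + n            ≡⟨ pos-+ k n ⟨
    + (k ℕ.+ n)          ∎)
    where
    open ≡-Reasoning
    x≡[x-y]+y : ∀ x y → x ≡ (x - y) + y
    x≡[x-y]+y = solve-∀

  +m-+n≡-k⇒m+k≡n : ∀ {m n k} → + m - + n ≡ - + k → m ℕ.+ k ≡ n
  +m-+n≡-k⇒m+k≡n {m} {n} {k} e = +-injective (begin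
    + (m ℕ.+ k)          ≡⟨ pos-+ m k ⟩
    + m + + k            ≡⟨ x+z≡[x-y]+z+y (+ m) (+ n) (+ k) ⟩
    (+ m - + n) + + k + + n  ≡⟨ cong (λ d → d + + k + + n) e ⟩
    - + k + + k + + n    ≡⟨ -z+z+y≡y (+ k) (+ n) ⟩
    + n                  ∎)
    where
    open ≡-Reasoning
    x+z≡[x-y]+z+y : ∀ x y z → x + z ≡ (x - y) + z + y
    x+z≡[x-y]+z+y = solve-∀
    -z+z+y≡y : ∀ z y → - z + z + y ≡ y
    -z+z+y≡y = solve-∀

  unit⇒Norm± : ∀ {D a b} → IsUnit D a b → Norm± ℤ.∣ a ∣ (D ℕ.* (ℤ.∣ b ∣ ℕ.* ℤ.∣ b ∣))
  unit⇒Norm± {D} {a} {b} (inj₁ N≡1)  = inj₁ (+m-+n≡+k⇒m≡k+n (trans (sym (cong₂ _-_ (sq≡+∣∣*∣∣ a) (+D*sq≡ D b))) N≡1))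
  unit⇒Norm± {D} {a} {b} (inj₂ N≡-1) = inj₂ (+m-+n≡-k⇒m+k≡n (trans (sym (cong₂ _-_ (sq≡+∣∣*∣∣ a) (+D*sq≡ D b))) N≡-1))

  Norm±⇒X≤α²+1 : ∀ {α X} → Norm± α X → X ℕ.≤ α ℕ.* α ℕ.+ 1
  Norm±⇒X≤α²+1 {X = X} (inj₁ α²≡1+X) =
    ℕ.≤-trans (ℕ.m≤n+m X 1) (ℕ.≤-trans (ℕ.≤-reflexive (sym α²≡1+X)) (ℕ.m≤m+n _ 1))
  Norm±⇒X≤α²+1 (inj₂ α²+1≡X) = ℕ.≤-reflexive (sym α²+1≡X)

  Norm±⇒α²≤X+1 : ∀ {α X} → Norm± α X → α ℕ.* α ℕ.≤ X ℕ.+ 1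
  Norm±⇒α²≤X+1 {X = X} (inj₁ α²≡1+X) = ℕ.≤-reflexive (trans α²≡1+X (ℕ.+-comm 1 X))
  Norm±⇒α²≤X+1 {X = X} (inj₂ α²+1≡X) = ℕ.≤-trans (ℕ.m≤m+n _ 1) (ℕ.≤-trans (ℕ.≤-reflexive α²+1≡X) (ℕ.m≤m+n X 1))

  [1+α]²≮X : ∀ {α X} → Norm± α X → ¬ suc α ℕ.* suc α ℕ.< X
  [1+α]²≮X {α} {X} N [1+α]²<X = ℕ.<⇒≱ [1+α]²<X (begin
    X                    ≤⟨ Norm±⇒X≤α²+1 {α} {X} N ⟩
    α ℕ.* α ℕ.+ 1        ≤⟨ ℕ.m≤m+n _ (α ℕ.+ α) ⟩
    α ℕ.* α ℕ.+ 1 ℕ.+ (α ℕ.+ α)  ≡⟨ solve (α ∷ []) ⟩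
    suc α ℕ.* suc α      ∎)
    where open ℕ.≤-Reasoning

  X≮[1+α]² : ∀ {α X} → Norm± (suc (suc α)) X → ¬ X ℕ.< suc α ℕ.* suc α
  X≮[1+α]² {α} {X} N X<[1+α]² = ℕ.<⇒≱ (ℕ.*-mono-< (ℕ.n<1+n (suc α)) (ℕ.n<1+n (suc α))) (begin
    suc (suc α) ℕ.* suc (suc α)  ≤⟨ Norm±⇒α²≤X+1 {suc (suc α)} {X} N ⟩
    X ℕ.+ 1                      ≡⟨ ℕ.+-comm X 1 ⟩
    suc X                        ≤⟨ X<[1+α]² ⟩
    suc α ℕ.* suc α              ∎)
    where open ℕ.≤-Reasoning

  sq+≡ : ∀ n → + 1 * sq (+ n) ≡ + (n ℕ.* n)
  sq+≡ n = trans (*-identityˡ (sq (+ n))) (sq≡+∣∣*∣∣ (+ n))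

  -- The conjugate ±1/ε of ε lies in (-1, 1), which forces a, b > 0.
  unit>1⇒positive : ∀ {D a b} → IsUnit D a b → GtOne D a b →
                    ∃₂ λ A S → a ≡ + A × b ≡ + S × 1 ℕ.≤ S × Norm± A (D ℕ.* (S ℕ.* S))
  unit>1⇒positive {D} {a} {b} unit ε>1 = positive a b ε>1 (unit⇒Norm± {D} {a} {b} unit)
    where
    positive : ∀ a b → Pos 1 D (a - + 1) b → Norm± ℤ.∣ a ∣ (D ℕ.* (ℤ.∣ b ∣ ℕ.* ℤ.∣ b ∣)) →
               ∃₂ λ A S → a ≡ + A × b ≡ + S × 1 ℕ.≤ S × Norm± A (D ℕ.* (S ℕ.* S))
    positive (+ suc A) (+ suc B) (inj₁ _) N = suc A , suc B , refl , refl , s≤s z≤n , N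
    positive (+ suc A) (+ 0) (inj₁ (_ , _ , ¬a-1≡0∧b≡0)) (inj₁ α²≡1+D0)
      with ℕ.m+n≡0⇒m≡0 A (ℕ.suc-injective (trans α²≡1+D0 (cong suc (ℕ.*-zeroʳ D))))
    ... | refl = ⊥-elim (¬a-1≡0∧b≡0 (refl , refl))
    positive (+ suc A) (+ 0) (inj₁ _) (inj₂ α²+1≡D0) with trans α²+1≡D0 (ℕ.*-zeroʳ D)
    ... | ()
    positive (+ 0)     _ (inj₁ (() , _ , _)) _
    positive -[1+ _ ]  _ (inj₁ (() , _ , _)) _
    positive (+ suc _) -[1+ _ ] (inj₁ (_ , () , _)) _
    positive (+ suc (suc A)) -[1+ B ] (inj₂ (inj₁ (_ , _ , Db²<[a-1]²))) N =
      ⊥-elim (X≮[1+α]² {A} N (drop‿+<+ (subst₂ ℤ._<_ (+D*sq≡ D -[1+ B ]) (sq+≡ (suc A)) Db²<[a-1]²)))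
    positive (+ 0)     _ (inj₂ (inj₁ (() , _ , _))) _
    positive (+ 1)     _ (inj₂ (inj₁ (+<+ () , _ , _))) _
    positive -[1+ _ ]  _ (inj₂ (inj₁ (() , _ , _))) _
    positive (+ suc (suc _)) (+ _) (inj₂ (inj₁ (_ , +<+ () , _))) _
    positive (+ suc _) _ (inj₂ (inj₂ (+<+ () , _ , _))) _
    positive _ (+ 0)     (inj₂ (inj₂ (_ , +<+ () , _))) _
    positive _ -[1+ _ ]  (inj₂ (inj₂ (_ , () , _))) _
    positive (+ 0) (+ suc B) (inj₂ (inj₂ (_ , _ , [a-1]²<Db²))) N =
      ⊥-elim ([1+α]²≮X {0} N (drop‿+<+ (subst₂ ℤ._<_ refl (+D*sq≡ D (+ suc B)) [a-1]²<Db²)))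
    positive -[1+ n ] (+ suc B) (inj₂ (inj₂ (_ , _ , [a-1]²<Db²))) N =
      ⊥-elim ([1+α]²≮X {suc n} N (drop‿+<+ (subst₂ ℤ._<_ [a-1]²≡ (+D*sq≡ D (+ suc B)) [a-1]²<Db²)))
      where
      [a-1]²≡ : + 1 * sq (-[1+ n ] - + 1) ≡ + (suc (suc n) ℕ.* suc (suc n))
      [a-1]²≡ = trans (*-identityˡ _) (trans (sq≡+∣∣*∣∣ (-[1+ n ] - + 1))
                                            (cong (λ m → + (suc (suc m) ℕ.* suc (suc m))) (ℕ.+-identityʳ n)))

  0≤+m-+n : ∀ {m n} → n ℕ.≤ m → + 0 ℤ.≤ + m - + n
  0≤+m-+n n≤m = subst (+ 0 ℤ.≤_) (sym (+m-+n≡+ n≤m)) (+≤+ z≤n)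

  positive-factors : ∀ u v → 1 ℕ.≤ 2 ℕ.* (u ℕ.* v) → 1 ℕ.≤ u × 1 ℕ.≤ v
  positive-factors (suc _) (suc _) _ = s≤s z≤n , s≤s z≤n
  positive-factors zero _ ()
  positive-factors (suc u) zero 1≤2[u0] with () ← subst (1 ℕ.≤_) (cong (2 ℕ.*_) (ℕ.*-zeroʳ (suc u))) 1≤2[u0]

  -- If ε = (u + v√D)² then u + v√D would be a smaller unit greater than 1.
  fundamental-unit-not-square : ∀ {D A S} → IsFundamentalUnit D (+ A) (+ S) → 1 ℕ.≤ S → NotSquare D A S
  fundamental-unit-not-square {D} {A} {S} (_ , _ , minimal) 1≤S u v u²≡1+Dv² A≡u²+Dv² S≡2uv =
    minimal (+ u) (+ v) η-unit η>1
      (inj₁ (0≤+m-+n u≤A , 0≤+m-+n (ℕ.<⇒≤ v<S) , λ (_ , S-v≡0) → ℕ.<⇒≢ v<S (sym (S≡v S-v≡0))))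
    where
    1≤u,1≤v : 1 ℕ.≤ u × 1 ℕ.≤ v
    1≤u,1≤v = positive-factors u v (subst (1 ℕ.≤_) S≡2uv 1≤S)
    1≤u : 1 ℕ.≤ u
    1≤u = proj₁ 1≤u,1≤v
    1≤v : 1 ℕ.≤ v
    1≤v = proj₂ 1≤u,1≤v
    instance _ = ℕ.>-nonZero 1≤u
    u≤A : u ℕ.≤ A
    u≤A = ℕ.≤-trans (ℕ.m≤m*n u u) (subst (u ℕ.* u ℕ.≤_) (sym A≡u²+Dv²) (ℕ.m≤m+n _ _))
    v<S : v ℕ.< S
    v<S = begin-strict
      v                        <⟨ ℕ.m<n+m v (ℕ.≤-trans 1≤v v≤uv) ⟩
      u ℕ.* v ℕ.+ v            ≤⟨ ℕ.+-monoʳ-≤ (u ℕ.* v) v≤uv ⟩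
      u ℕ.* v ℕ.+ u ℕ.* v      ≡⟨ solve (u ∷ v ∷ []) ⟩
      2 ℕ.* (u ℕ.* v)          ≡⟨ S≡2uv ⟨
      S                        ∎
      where
      open ℕ.≤-Reasoning
      v≤uv : v ℕ.≤ u ℕ.* v
      v≤uv = ℕ.m≤n*m v u
    S≡v : + S - + v ≡ + 0 → S ≡ v
    S≡v S-v≡0 = sym (trans (ℕ.+-identityˡ v) (sym (+m-+n≡+k⇒m≡k+n S-v≡0)))
    η-unit : IsUnit D (+ u) (+ v)
    η-unit = inj₁ (begin
      sq (+ u) - + D * sq (+ v)                    ≡⟨ cong₂ _-_ (sq≡+∣∣*∣∣ (+ u)) (+D*sq≡ D (+ v)) ⟩
      + (u ℕ.* u) - + (D ℕ.* (v ℕ.* v))            ≡⟨ +m-+n≡+ (subst (D ℕ.* (v ℕ.* v) ℕ.≤_) (sym u²≡1+Dv²) (ℕ.m≤n+m _ 1)) ⟩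
      + (u ℕ.* u ℕ.∸ D ℕ.* (v ℕ.* v))              ≡⟨ cong (λ m → + (m ℕ.∸ D ℕ.* (v ℕ.* v))) u²≡1+Dv² ⟩
      + (1 ℕ.+ D ℕ.* (v ℕ.* v) ℕ.∸ D ℕ.* (v ℕ.* v)) ≡⟨ cong +_ (ℕ.m+n∸n≡m 1 (D ℕ.* (v ℕ.* v))) ⟩
      + 1                                          ∎)
      where open ≡-Reasoning
    η>1 : GtOne D (+ u) (+ v)
    η>1 = inj₁ (0≤+m-+n 1≤u , +≤+ z≤n , λ (_ , v≡0) → ℕ.<⇒≢ 1≤v (sym (+-injective v≡0)))

  module SumAndDifferenceOfSquares {m n A U V : ℕ} (A≡mV²+1 : A ≡ m ℕ.* (V ℕ.* V) ℕ.+ 1)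
                                   (A+1≡nU² : A ℕ.+ 1 ≡ n ℕ.* (U ℕ.* U)) where

    nU²≡mV²+2 : n ℕ.* (U ℕ.* U) ≡ m ℕ.* (V ℕ.* V) ℕ.+ 2
    nU²≡mV²+2 = trans (sym A+1≡nU²) (trans (cong (ℕ._+ 1) A≡mV²+1) (ℕ.+-assoc _ 1 1))

    mV²+nU²≡2A : m ℕ.* (V ℕ.* V) ℕ.+ n ℕ.* (U ℕ.* U) ≡ 2 ℕ.* A
    mV²+nU²≡2A = begin
      m ℕ.* (V ℕ.* V) ℕ.+ n ℕ.* (U ℕ.* U)          ≡⟨ cong (m ℕ.* (V ℕ.* V) ℕ.+_) nU²≡mV²+2 ⟩
      m ℕ.* (V ℕ.* V) ℕ.+ (m ℕ.* (V ℕ.* V) ℕ.+ 2)  ≡⟨ solve (m ∷ V ∷ []) ⟩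
      2 ℕ.* (m ℕ.* (V ℕ.* V) ℕ.+ 1)                ≡⟨ cong (2 ℕ.*_) A≡mV²+1 ⟨
      2 ℕ.* A                                       ∎
      where open ≡-Reasoning

    sum-of-squares : + m * sq (+ V) + + n * sq (+ U) ≡ + 2 * + A
    sum-of-squares = begin
      + m * sq (+ V) + + n * sq (+ U)                ≡⟨ cong₂ _+_ (+D*sq≡ m (+ V)) (+D*sq≡ n (+ U)) ⟩
      + (m ℕ.* (V ℕ.* V)) + + (n ℕ.* (U ℕ.* U))      ≡⟨ pos-+ (m ℕ.* (V ℕ.* V)) (n ℕ.* (U ℕ.* U)) ⟨
      + (m ℕ.* (V ℕ.* V) ℕ.+ n ℕ.* (U ℕ.* U))        ≡⟨ cong +_ mV²+nU²≡2A ⟩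
      + (2 ℕ.* A)                                    ≡⟨ pos-* 2 A ⟩
      + 2 * + A                                      ∎
      where open ≡-Reasoning

    difference-of-squares : + n * sq (+ U) - + m * sq (+ V) ≡ + 2
    difference-of-squares = begin
      + n * sq (+ U) - + m * sq (+ V)               ≡⟨ cong₂ _-_ (+D*sq≡ n (+ U)) (+D*sq≡ m (+ V)) ⟩
      + (n ℕ.* (U ℕ.* U)) - + (m ℕ.* (V ℕ.* V))     ≡⟨ cong (λ k → + k - + (m ℕ.* (V ℕ.* V))) nU²≡mV²+2 ⟩
      + (m ℕ.* (V ℕ.* V) ℕ.+ 2) - + (m ℕ.* (V ℕ.* V)) ≡⟨ +m-+n≡+ (ℕ.m≤m+n (m ℕ.* (V ℕ.* V)) 2) ⟩
      + (m ℕ.* (V ℕ.* V) ℕ.+ 2 ℕ.∸ m ℕ.* (V ℕ.* V)) ≡⟨ cong +_ (ℕ.m+n∸m≡n (m ℕ.* (V ℕ.* V)) 2) ⟩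
      + 2                                           ∎
      where open ≡-Reasoning

  sqrt-2ε-in-√m,√n : ∀ {m n A S} → Sqrt2ε₂ m n A S →
    IsSquareℕ (+ m * (+ A - + 1)) ×
    ∃[ b₁ ] ∃[ b₂ ] (SqrtTwoEps m n (+ A) (+ S) b₁ b₂ × + 2 ≡ - (+ m * sq b₁) + + n * sq b₂)
  sqrt-2ε-in-√m,√n {m} {n} {A} {S} (sqrt2ε₂ U V A≡mV²+1 A+1≡nU² VU≡S) =
    (m ℕ.* V , m[A-1]≡[mV]²) ,
    + V , + U , (inj₁ (+≤+ z≤n , +≤+ z≤n) , sum-of-squares , trans (sym (pos-* V U)) (cong +_ VU≡S)) ,
    trans (sym difference-of-squares) (+-comm (+ n * sq (+ U)) (- (+ m * sq (+ V))))
    where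
    open SumAndDifferenceOfSquares {m} {n} {A} {U} {V} A≡mV²+1 A+1≡nU²
    m[A-1]≡[mV]² : + m * (+ A - + 1) ≡ + (m ℕ.* V ℕ.* (m ℕ.* V))
    m[A-1]≡[mV]² = begin
      + m * (+ A - + 1)                       ≡⟨ cong (+ m *_) (+m-+n≡+ (subst (1 ℕ.≤_) (sym A≡mV²+1) (ℕ.m≤n+m 1 _))) ⟩
      + m * + (A ℕ.∸ 1)                       ≡⟨ cong (λ a → + m * + (a ℕ.∸ 1)) A≡mV²+1 ⟩
      + m * + (m ℕ.* (V ℕ.* V) ℕ.+ 1 ℕ.∸ 1)   ≡⟨ cong (λ k → + m * + k) (ℕ.m+n∸n≡m _ 1) ⟩
      + m * + (m ℕ.* (V ℕ.* V))               ≡⟨ pos-* m _ ⟨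
      + (m ℕ.* (m ℕ.* (V ℕ.* V)))             ≡⟨ cong +_ (solve (m ∷ V ∷ [])) ⟩
      + (m ℕ.* V ℕ.* (m ℕ.* V))               ∎
      where open ≡-Reasoning

  sqrt-2ε-in-1,√n : ∀ {n A S} → Sqrt2ε₁ n A S →
    IsSquareℕ (+ A + + 1) ×
    ∃[ d₁ ] ∃[ d₂ ] (SqrtTwoEps 1 n (+ A) (+ S) d₁ d₂ × + 2 ≡ sq d₁ - + n * sq d₂)
  sqrt-2ε-in-1,√n {n} {A} {S} (sqrt2ε₁ U V A+1≡U² A≡nV²+1 UV≡S) =
    (U , trans (sym (pos-+ A 1)) (cong +_ A+1≡U²)) ,
    + U , + V , (inj₁ (+≤+ z≤n , +≤+ z≤n) , trans (+-comm (+ 1 * sq (+ U)) (+ n * sq (+ V))) sum-of-squares ,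
                 trans (sym (pos-* U V)) (cong +_ UV≡S)) ,
    trans (sym difference-of-squares) (cong (_- + n * sq (+ V)) (*-identityˡ (sq (+ U))))
    where
    open SumAndDifferenceOfSquares {n} {1} {A} {U} {V} A≡nV²+1 (trans A+1≡U² (sym (ℕ.*-identityˡ (U ℕ.* U))))

  fundamental-unit⇒solution : ∀ {D a b} → IsFundamentalUnit D a b → (∀ A X → A ℕ.* A ℕ.+ 1 ≢ D ℕ.* X) →
    ∃₂ λ A S → a ≡ + A × b ≡ + S × A ℕ.* A ≡ 1 ℕ.+ D ℕ.* (S ℕ.* S) × NotSquare D A S
  fundamental-unit⇒solution {D} {a} {b} ε@(unit , ε>1 , _) norm≢-1 with unit>1⇒positive {D} {a} {b} unit ε>1
  ... | A , S , a≡A , b≡S , 1≤S , inj₁ A²≡1+DS² =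
    A , S , a≡A , b≡S , A²≡1+DS² , fundamental-unit-not-square {D} (subst₂ (IsFundamentalUnit D) a≡A b≡S ε) 1≤S
  ... | A , S , _ , _ , _ , inj₂ A²+1≡DS² = ⊥-elim (norm≢-1 A (S ℕ.* S) A²+1≡DS²)

module CoprimeFactorisation where

  open import Data.Nat
  open import Data.Nat.Properties
  open import Data.Nat.DivMod using (m/n*n≡m)
  open import Data.Nat.Divisibility
  open import Data.Nat.GCD using (gcd; gcd[m,n]∣m; gcd[m,n]∣n; gcd[m,n]≢0)
  open import Data.Nat.Coprimality using (Coprime; coprime-divisor; coprime-/gcd)
  import Data.Nat.Coprimality as Coprimality
  open import Data.Nat.Primality using (Prime; euclidsLemma; prime⇒nonZero)
  open import Data.Nat.ListAction using (product)
  open import Data.Nat.Tactic.RingSolver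
  open import Data.List using (List; []; _∷_)
  open import Data.List.Relation.Unary.All as All using (All)
  open import Data.Product
  open import Data.Sum
  open import Relation.Binary using (tri<; tri≈; tri>)
  open import Relation.Binary.PropositionalEquality
  open import Algebra.Properties.CommutativeSemigroup *-commutativeSemigroup using (xy∙z≈xz∙y; x∙yz≈y∙xz)
  open import Relation.Nullary using (contradiction)

  coprime-∣ˡ : ∀ {a b d} → Coprime a b → d ∣ a → Coprime d b
  coprime-∣ˡ a⊥b d∣a (c∣d , c∣b) = a⊥b (∣-trans c∣d d∣a , c∣b)

  coprime-*ʳ : ∀ {a b c} → Coprime a b → Coprime a c → Coprime a (b * c)
  coprime-*ʳ a⊥b a⊥c (d∣a , d∣bc) = a⊥c (d∣a , coprime-divisor (coprime-∣ˡ a⊥b d∣a) d∣bc)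

  [ab]²≡a²b² : ∀ a b → a * b * (a * b) ≡ a * a * (b * b)
  [ab]²≡a²b² a b = solve (a ∷ b ∷ [])

  -- Writing g = gcd x z, x = x' g and z = z' g, the factors x' and g divide each other.
  coprime-factor-of-square : ∀ {x y z} → Coprime x y → x * y ≡ z * z → ∃[ u ] x ≡ u * u
  coprime-factor-of-square {zero} _ _ = 0 , refl
  coprime-factor-of-square {suc n} {y} {z} = nonzero-case {suc n} {y} {z} (λ ())
    where
    nonzero-case : ∀ {x y z} → x ≢ 0 → Coprime x y → x * y ≡ z * z → ∃[ u ] x ≡ u * u
    nonzero-case {x} {y} {z} x≢0 x⊥y xy≡z² = g , trans x≡x'g (cong (_* g) x'≡g)
      where
      g : ℕ
      g = gcd x z
      instance _ = ≢-nonZero (gcd[m,n]≢0 x z (inj₁ x≢0))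
      x' z' : ℕ
      x' = x / g
      z' = z / g
      x≡x'g : x ≡ x' * g
      x≡x'g = sym (m/n*n≡m (gcd[m,n]∣m x z))
      z≡z'g : z ≡ z' * g
      z≡z'g = sym (m/n*n≡m (gcd[m,n]∣n x z))
      x'y≡z'²g : x' * y ≡ z' * z' * g
      x'y≡z'²g = *-cancelʳ-≡ (x' * y) (z' * z' * g) g (begin
        x' * y * g          ≡⟨ xy∙z≈xz∙y x' y g ⟩
        x' * g * y          ≡⟨ cong (_* y) x≡x'g ⟨
        x * y               ≡⟨ xy≡z² ⟩
        z * z               ≡⟨ cong₂ _*_ z≡z'g z≡z'g ⟩
        z' * g * (z' * g)   ≡⟨ [ab]²≡a²b² z' g ⟩
        z' * z' * (g * g)   ≡⟨ *-assoc (z' * z') g g ⟨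
        z' * z' * g * g     ∎)
        where open ≡-Reasoning
      x'∣g : x' ∣ g
      x'∣g = coprime-divisor (coprime-*ʳ x'⊥z' x'⊥z') (divides y (trans (sym x'y≡z'²g) (*-comm x' y)))
        where
        x'⊥z' : Coprime x' z'
        x'⊥z' = coprime-/gcd x z
      g∣x' : g ∣ x'
      g∣x' = coprime-divisor (coprime-∣ˡ x⊥y (gcd[m,n]∣m x z)) (divides (z' * z') (trans (*-comm y x') x'y≡z'²g))
      x'≡g : x' ≡ g
      x'≡g = ∣-antisym x'∣g g∣x'

  square-injective : ∀ {a b} → a * a ≡ b * b → a ≡ b
  square-injective {a} {b} a²≡b² with <-cmp a b
  ... | tri< a<b _ _ = contradiction a²≡b² (<⇒≢ (*-mono-< a<b a<b))
  ... | tri≈ _ a≡b _ = a≡b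
  ... | tri> _ _ b<a = contradiction (sym a²≡b²) (<⇒≢ (*-mono-< b<a b<a))

  coprime-factors-of-square : ∀ {x y z} → Coprime x y → x * y ≡ z * z →
                              ∃₂ λ u v → x ≡ u * u × y ≡ v * v × u * v ≡ z
  coprime-factors-of-square {x} {y} {z} x⊥y xy≡z²
    with coprime-factor-of-square {z = z} x⊥y xy≡z² | coprime-factor-of-square {z = z} (Coprimality.sym x⊥y) (trans (*-comm y x) xy≡z²)
  ... | u , x≡u² | v , y≡v² = u , v , x≡u² , y≡v² , square-injective (begin
      u * v * (u * v)    ≡⟨ [ab]²≡a²b² u v ⟩
      u * u * (v * v)    ≡⟨ cong₂ _*_ x≡u² y≡v² ⟨
      x * y              ≡⟨ xy≡z² ⟩
      z * z              ∎)
    where open ≡-Reasoning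

  prime-divides-coprime-product : ∀ {r x y M} → Prime r → Coprime x y → x * y ≡ r * M →
    (∃[ x' ] x ≡ r * x' × x' * y ≡ M × Coprime x' y) ⊎ (∃[ y' ] y ≡ r * y' × x * y' ≡ M × Coprime x y')
  prime-divides-coprime-product {r} {x} {y} {M} r-prime x⊥y xy≡rM
    with euclidsLemma x y r-prime (divides M (trans xy≡rM (*-comm r M)))
  ... | inj₁ (divides x' x≡x'r) = inj₁ (x' , x≡rx' , *-cancelˡ-≡ (x' * y) M r (begin
        r * (x' * y)   ≡⟨ *-assoc r x' y ⟨
        r * x' * y     ≡⟨ cong (_* y) x≡rx' ⟨
        x * y          ≡⟨ xy≡rM ⟩
        r * M          ∎) , coprime-∣ˡ x⊥y (divides r x≡rx'))
    where
    open ≡-Reasoning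
    instance _ = prime⇒nonZero r-prime
    x≡rx' : x ≡ r * x'
    x≡rx' = trans x≡x'r (*-comm x' r)
  ... | inj₂ (divides y' y≡y'r) = inj₂ (y' , y≡ry' , *-cancelˡ-≡ (x * y') M r (begin
        r * (x * y')   ≡⟨ x∙yz≈y∙xz r x y' ⟩
        x * (r * y')   ≡⟨ cong (x *_) y≡ry' ⟨
        x * y          ≡⟨ xy≡rM ⟩
        r * M          ∎) , Coprimality.sym (coprime-∣ˡ (Coprimality.sym x⊥y) (divides r y≡ry')))
    where
    open ≡-Reasoning
    instance _ = prime⇒nonZero r-prime
    y≡ry' : y ≡ r * y'
    y≡ry' = trans y≡y'r (*-comm y' r)

  -- A coprime factorisation x y = r₁ ⋯ rₖ z² distributes each prime rᵢ to x or to y.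
  Splits : List ℕ → (x y z : ℕ) → Set
  Splits []       x y z = ∃₂ λ u v → x ≡ u * u × y ≡ v * v × u * v ≡ z
  Splits (r ∷ rs) x y z = (∃[ x' ] x ≡ r * x' × Splits rs x' y z) ⊎ (∃[ y' ] y ≡ r * y' × Splits rs x y' z)

  splits : ∀ {rs} → All Prime rs → ∀ {x y z} → Coprime x y → x * y ≡ product rs * (z * z) → Splits rs x y z
  splits All.[] x⊥y xy≡z² = coprime-factors-of-square x⊥y (trans xy≡z² (+-identityʳ _))
  splits {r ∷ rs} (r-prime All.∷ primes) {z = z} x⊥y xy≡rMz²
    with prime-divides-coprime-product r-prime x⊥y (trans xy≡rMz² (*-assoc r (product rs) (z * z)))
  ... | inj₁ (x' , x≡rx' , x'y≡Mz² , x'⊥y) = inj₁ (x' , x≡rx' , splits primes x'⊥y x'y≡Mz²)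
  ... | inj₂ (y' , y≡ry' , xy'≡Mz² , x⊥y') = inj₂ (y' , y≡ry' , splits primes x⊥y' xy'≡Mz²)

module Decompositions where

  open import Data.Nat
  open import Data.Nat.Properties
  open import Data.Nat.Coprimality using (Coprime)
  open import Data.Nat.Primality using (Prime; prime[2])
  open import Data.Nat.Tactic.RingSolver
  open import Data.List using (_∷_; [])
  open import Data.List.Relation.Unary.All as All using (All)
  open import Data.Product
  open import Data.Sum
  open import Data.Empty
  open import Function using (case_of_)
  open import Relation.Nullary
  open import Relation.Binary.PropositionalEquality
  open Congruence
  open QuadraticResidues
  open CoprimeFactorisation
  open NormEquation

  module SqrtTwoEpsilon {q : ℕ} .{{_ : NonZero q}} (q-prime : Prime q) (q≡3[mod4] : q % 4 ≡ 3)
                        (w : ℕ) (w²≡2 : w * w ≡ 2 [mod q ]) where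

    open PrimeThreeModFour q-prime q≡3[mod4] w w²≡2

    q≢0[mod4] : ¬ q % 4 ≡ 0
    q≢0[mod4] q≡0 with () ← trans (sym q≡0) q≡3[mod4]

    sqrt2ε[q] : ∀ {A S} → A * A ≡ 1 + q * (S * S) → NotSquare q A S → Sqrt2ε₁ q A S
    sqrt2ε[q] {A} {S} A²≡1+qS² not-square = case odd⊎double A of λ where
        (inj₂ (j , A≡2j)) → even-A (halve-even-A {A} {q} {S} A²≡1+qS² {j} A≡2j)
        (inj₁ A-odd) → ⊥-elim (odd-A (halve-odd-A {A} {q} {S} A²≡1+qS² A-odd q≢0[mod4]))
      where
      even-A : ∃[ y ] A ≡ y + 1 × Coprime (y + 2) y × (y + 2) * y ≡ q * (S * S) → Sqrt2ε₁ q A S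
      even-A (y , A≡y+1 , y+2⊥y , [y+2]y≡qS²)
        with splits (q-prime All.∷ All.[]) {z = S} y+2⊥y (trans [y+2]y≡qS² (cong (_* (S * S)) (sym (*-identityʳ q))))
      ... | inj₁ (_ , v²+2≡qu² , u , v , refl , refl , _) =
        ⊥-elim (-2-non-residue v (≡n*⇒≡0-mod (u * u) v²+2≡qu²))
      ... | inj₂ (_ , refl , u , v , qv²+2≡u² , refl , uv≡S) =
        sqrt2ε₁ u v (trans (cong (_+ 1) A≡y+1) (trans (+-assoc _ 1 1) qv²+2≡u²)) A≡y+1 uv≡S
      odd-A : ∃₂ (λ y z → A ≡ 2 * y + 1 × S ≡ 2 * z × Coprime (y + 1) y × (y + 1) * y ≡ q * (z * z)) → ⊥
      odd-A (y , z , A≡2y+1 , S≡2z , y+1⊥y , [y+1]y≡qz²)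
        with splits (q-prime All.∷ All.[]) {z = z} y+1⊥y (trans [y+1]y≡qz² (cong (_* (z * z)) (sym (*-identityʳ q))))
      ... | inj₁ (_ , v²+1≡qu² , u , v , refl , refl , _) =
        -1-non-residue v (≡n*⇒≡0-mod (u * u) v²+1≡qu²)
      ... | inj₂ (_ , refl , u , v , qv²+1≡u² , refl , uv≡z) =
        not-square-leaf {D = q} {u = u} {v = v} not-square A≡2y+1 S≡2z qv²+1≡u² refl uv≡z

    sqrt2ε[2q] : ∀ {A S} → A * A ≡ 1 + 2 * q * (S * S) → NotSquare (2 * q) A S → Sqrt2ε₁ (2 * q) A S
    sqrt2ε[2q] {A} {S} A²≡1+2qS² not-square = from-halves (halve-odd-A {A} {2 * q} {S} A²≡1+2qS² A-odd 2q≢0[mod4])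
      where
      A-odd : A % 2 ≡ 1
      A-odd = even-D⇒odd-A {A} {2 * q} {S} A²≡1+2qS² ([2n]%2≡0 q)
      2q≢0[mod4] : ¬ (2 * q) % 4 ≡ 0
      2q≢0[mod4] = 2*odd⇒≢0[mod4] {q} q-odd
      from-halves : ∃₂ (λ y z → A ≡ 2 * y + 1 × S ≡ 2 * z × Coprime (y + 1) y × (y + 1) * y ≡ 2 * q * (z * z)) →
                    Sqrt2ε₁ (2 * q) A S
      from-halves (y , z , A≡2y+1 , S≡2z , y+1⊥y , [y+1]y≡2qz²)
        with splits (prime[2] All.∷ q-prime All.∷ All.[]) {z = z} y+1⊥y
                    (trans [y+1]y≡2qz² (cong (λ k → 2 * k * (z * z)) (sym (*-identityʳ q))))
      ... | inj₁ (_ , v²+1≡2qu² , inj₁ (_ , refl , u , v , refl , refl , _)) =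
        ⊥-elim (-1-non-residue v (≡n*⇒≡0-mod (2 * (u * u)) (trans v²+1≡2qu² (solve (q ∷ u ∷ [])))))
      ... | inj₁ (_ , qv²+1≡2u² , inj₂ (_ , refl , u , v , refl , refl , uv≡z)) =
        sqrt2ε₁ (2 * u) v (begin
          A + 1                      ≡⟨ cong (_+ 1) A≡2y+1 ⟩
          2 * (q * (v * v)) + 1 + 1  ≡⟨ solve (q ∷ v ∷ []) ⟩
          2 * (q * (v * v) + 1)      ≡⟨ cong (2 *_) qv²+1≡2u² ⟩
          2 * (2 * (u * u))          ≡⟨ solve (u ∷ []) ⟩
          2 * u * (2 * u)            ∎)
        (trans A≡2y+1 (cong (_+ 1) (sym (*-assoc 2 q (v * v)))))
        (trans (*-assoc 2 u v) (trans (cong (2 *_) uv≡z) (sym S≡2z)))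
        where open ≡-Reasoning
      ... | inj₂ (_ , refl , inj₁ (_ , 2v²+1≡qu² , u , v , refl , refl , _)) =
        ⊥-elim (-2-non-residue (2 * v) (≡n*⇒≡0-mod (2 * (u * u)) (begin
          2 * v * (2 * v) + 2        ≡⟨ solve (v ∷ []) ⟩
          2 * (2 * (v * v) + 1)      ≡⟨ cong (2 *_) 2v²+1≡qu² ⟩
          2 * (q * (u * u))          ≡⟨ solve (q ∷ u ∷ []) ⟩
          q * (2 * (u * u))          ∎)))
        where open ≡-Reasoning
      ... | inj₂ (_ , refl , inj₂ (_ , refl , u , v , 2qv²+1≡u² , refl , uv≡z)) =
        ⊥-elim (not-square-leaf {D = 2 * q} {u = u} {v = v} not-square A≡2y+1 S≡2z 2qv²+1≡u² (sym (*-assoc 2 q (v * v))) uv≡z)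

    module _ {p : ℕ} .{{_ : NonZero p}} (p-prime : Prime p) (p≡1[mod4] : p % 4 ≡ 1)
             (2-non-residue : ∀ x → ¬ x * x ≡ 2 [mod p ]) (p-non-residue : ∀ x → ¬ x * x ≡ p [mod q ]) where

      pq-odd : (p * q) % 2 ≡ 1
      pq-odd = odd*odd {p} {q} (trans (sym (%4%2 p)) (cong (_% 2) p≡1[mod4])) q-odd

      sqrt2ε[pq] : ∀ {A S} → A * A ≡ 1 + p * q * (S * S) → NotSquare (p * q) A S → Sqrt2ε₂ p q A S
      sqrt2ε[pq] {A} {S} A²≡1+pqS² not-square = case odd⊎double A of λ where
          (inj₂ (j , A≡2j)) → even-A (halve-even-A {A} {p * q} {S} A²≡1+pqS² {j} A≡2j)
          (inj₁ A-odd) → ⊥-elim (odd-A (halve-odd-A {A} {p * q} {S} A²≡1+pqS² A-odd (odd⇒≢0[mod4] {p * q} pq-odd)))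
        where
        pq≡product : ∀ z → p * q * (z * z) ≡ p * (q * 1) * (z * z)
        pq≡product z = cong (λ k → p * k * (z * z)) (sym (*-identityʳ q))
        even-A : ∃[ y ] A ≡ y + 1 × Coprime (y + 2) y × (y + 2) * y ≡ p * q * (S * S) → Sqrt2ε₂ p q A S
        even-A (y , A≡y+1 , y+2⊥y , [y+2]y≡pqS²)
          with splits (p-prime All.∷ q-prime All.∷ All.[]) {z = S} y+2⊥y (trans [y+2]y≡pqS² (pq≡product S))
        ... | inj₁ (_ , v²+2≡pqu² , inj₁ (_ , refl , u , v , refl , refl , _)) =
          ⊥-elim (-2-non-residue v (≡n*⇒≡0-mod (p * (u * u)) (trans v²+2≡pqu² (solve (p ∷ q ∷ u ∷ [])))))
        ... | inj₁ (_ , qv²+2≡pu² , inj₂ (_ , refl , u , v , refl , refl , _)) =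
          ⊥-elim (p*square≢2 p-non-residue u (≡+k*n⇒≡-mod (v * v) (trans (sym qv²+2≡pu²) (solve (q ∷ v ∷ [])))))
        ... | inj₂ (_ , refl , inj₁ (_ , pv²+2≡qu² , u , v , refl , refl , uv≡S)) =
          sqrt2ε₂ u v A≡y+1 (trans (cong (_+ 1) A≡y+1) (trans (+-assoc _ 1 1) pv²+2≡qu²)) (trans (*-comm v u) uv≡S)
        ... | inj₂ (_ , refl , inj₂ (_ , refl , u , v , pqv²+2≡u² , refl , _)) =
          ⊥-elim (2-non-residue u (≡+k*n⇒≡-mod (q * (v * v)) (trans (sym pqv²+2≡u²) (solve (p ∷ q ∷ v ∷ [])))))
        odd-A : ∃₂ (λ y z → A ≡ 2 * y + 1 × S ≡ 2 * z × Coprime (y + 1) y × (y + 1) * y ≡ p * q * (z * z)) → ⊥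
        odd-A (y , z , A≡2y+1 , S≡2z , y+1⊥y , [y+1]y≡pqz²)
          with splits (p-prime All.∷ q-prime All.∷ All.[]) {z = z} y+1⊥y (trans [y+1]y≡pqz² (pq≡product z))
        ... | inj₁ (_ , v²+1≡pqu² , inj₁ (_ , refl , u , v , refl , refl , _)) =
          -1-non-residue v (≡n*⇒≡0-mod (p * (u * u)) (trans v²+1≡pqu² (solve (p ∷ q ∷ u ∷ []))))
        ... | inj₁ (_ , qv²+1≡pu² , inj₂ (_ , refl , u , v , refl , refl , _)) =
          p*square≢1 p-non-residue u (≡+k*n⇒≡-mod (v * v) (trans (sym qv²+1≡pu²) (solve (q ∷ v ∷ []))))
        ... | inj₂ (_ , refl , inj₁ (_ , pv²+1≡qu² , u , v , refl , refl , _)) =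
          q*square≢1+P*square {p} (inj₁ p≡1[mod4]) u v (trans (sym pv²+1≡qu²) (+-comm _ 1))
        ... | inj₂ (_ , refl , inj₂ (_ , refl , u , v , pqv²+1≡u² , refl , uv≡z)) =
          not-square-leaf {D = p * q} {u = u} {v = v} not-square A≡2y+1 S≡2z pqv²+1≡u² (sym (*-assoc p q (v * v))) uv≡z

      sqrt2ε[2pq] : ∀ {A S} → A * A ≡ 1 + 2 * p * q * (S * S) → NotSquare (2 * p * q) A S → Sqrt2ε₂ (2 * p) q A S
      sqrt2ε[2pq] {A} {S} A²≡1+2pqS² not-square = from-halves (halve-odd-A {A} {2 * p * q} {S} A²≡1+2pqS² A-odd 2pq≢0[mod4])
        where
        A-odd : A % 2 ≡ 1
        A-odd = even-D⇒odd-A {A} {2 * p * q} {S} A²≡1+2pqS² (trans (cong (_% 2) (*-assoc 2 p q)) ([2n]%2≡0 (p * q)))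
        2pq≢0[mod4] : ¬ (2 * p * q) % 4 ≡ 0
        2pq≢0[mod4] 2pq≡0 = 2*odd⇒≢0[mod4] {p * q} pq-odd (trans (cong (_% 4) (sym (*-assoc 2 p q))) 2pq≡0)
        from-halves : ∃₂ (λ y z → A ≡ 2 * y + 1 × S ≡ 2 * z × Coprime (y + 1) y × (y + 1) * y ≡ 2 * p * q * (z * z)) →
                      Sqrt2ε₂ (2 * p) q A S
        from-halves (y , z , A≡2y+1 , S≡2z , y+1⊥y , [y+1]y≡2pqz²)
          with splits (prime[2] All.∷ p-prime All.∷ q-prime All.∷ All.[]) {z = z} y+1⊥y
                      (trans [y+1]y≡2pqz² (cong (_* (z * z)) (trans (*-assoc 2 p q) (cong (λ k → 2 * (p * k)) (sym (*-identityʳ q))))))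
        ... | inj₁ (_ , v²+1≡2pqu² , inj₁ (_ , refl , inj₁ (_ , refl , u , v , refl , refl , _))) =
          ⊥-elim (-1-non-residue v (≡n*⇒≡0-mod (2 * (p * (u * u))) (trans v²+1≡2pqu² (solve (p ∷ q ∷ u ∷ [])))))
        ... | inj₁ (_ , qv²+1≡2pu² , inj₁ (_ , refl , inj₂ (_ , refl , u , v , refl , refl , _))) =
          ⊥-elim (p*square≢2 p-non-residue (2 * u) (≡+k*n⇒≡-mod (2 * (v * v)) (begin
            p * (2 * u * (2 * u))      ≡⟨ solve (p ∷ u ∷ []) ⟩
            2 * (2 * (p * (u * u)))    ≡⟨ cong (2 *_) qv²+1≡2pu² ⟨
            2 * (q * (v * v) + 1)      ≡⟨ solve (q ∷ v ∷ []) ⟩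
            2 + 2 * (v * v) * q        ∎)))
          where open ≡-Reasoning
        ... | inj₁ (_ , pv²+1≡2qu² , inj₂ (_ , refl , inj₁ (_ , refl , u , v , refl , refl , uv≡z))) =
          sqrt2ε₂ (2 * u) v (trans A≡2y+1 (cong (_+ 1) (sym (*-assoc 2 p (v * v))))) (begin
            A + 1                      ≡⟨ cong (_+ 1) A≡2y+1 ⟩
            2 * (p * (v * v)) + 1 + 1  ≡⟨ solve (p ∷ v ∷ []) ⟩
            2 * (p * (v * v) + 1)      ≡⟨ cong (2 *_) pv²+1≡2qu² ⟩
            2 * (2 * (q * (u * u)))    ≡⟨ solve (q ∷ u ∷ []) ⟩
            q * (2 * u * (2 * u))      ∎)
          (begin
            v * (2 * u)                ≡⟨ solve (u ∷ v ∷ []) ⟩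
            2 * (u * v)                ≡⟨ cong (2 *_) uv≡z ⟩
            2 * z                      ≡⟨ S≡2z ⟨
            S                          ∎)
          where open ≡-Reasoning
        ... | inj₁ (_ , pqv²+1≡2u² , inj₂ (_ , refl , inj₂ (_ , refl , u , v , refl , refl , _))) =
          ⊥-elim (2-non-residue (2 * u) (≡+k*n⇒≡-mod (2 * (q * (v * v))) (begin
            2 * u * (2 * u)              ≡⟨ solve (u ∷ []) ⟩
            2 * (2 * (u * u))            ≡⟨ cong (2 *_) pqv²+1≡2u² ⟨
            2 * (p * (q * (v * v)) + 1)  ≡⟨ solve (p ∷ q ∷ v ∷ []) ⟩
            2 + 2 * (q * (v * v)) * p    ∎)))
          where open ≡-Reasoning
        ... | inj₂ (_ , refl , inj₁ (_ , 2v²+1≡pqu² , inj₁ (_ , refl , u , v , refl , refl , _))) =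
          ⊥-elim (-2-non-residue (2 * v) (≡n*⇒≡0-mod (2 * (p * (u * u))) (begin
            2 * v * (2 * v) + 2          ≡⟨ solve (v ∷ []) ⟩
            2 * (2 * (v * v) + 1)        ≡⟨ cong (2 *_) 2v²+1≡pqu² ⟩
            2 * (p * (q * (u * u)))      ≡⟨ solve (p ∷ q ∷ u ∷ []) ⟩
            q * (2 * (p * (u * u)))      ∎)))
          where open ≡-Reasoning
        ... | inj₂ (_ , refl , inj₁ (_ , 2qv²+1≡pu² , inj₂ (_ , refl , u , v , refl , refl , _))) =
          ⊥-elim (p*square≢1 p-non-residue u (≡+k*n⇒≡-mod (2 * (v * v)) (trans (sym 2qv²+1≡pu²) (solve (q ∷ v ∷ [])))))
        ... | inj₂ (_ , refl , inj₂ (_ , refl , inj₁ (_ , 2pv²+1≡qu² , u , v , refl , refl , _))) =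
          ⊥-elim (q*square≢1+P*square {2 * p} (inj₂ (≡1[mod4]⇒2*≡2[mod8] {p} p≡1[mod4])) u v
                   (trans (sym 2pv²+1≡qu²) (trans (+-comm _ 1) (cong (1 +_) (sym (*-assoc 2 p (v * v)))))))
        ... | inj₂ (_ , refl , inj₂ (_ , refl , inj₂ (_ , refl , u , v , 2pqv²+1≡u² , refl , uv≡z))) =
          ⊥-elim (not-square-leaf {D = 2 * p * q} {u = u} {v = v} not-square A≡2y+1 S≡2z 2pqv²+1≡u²
                                  (solve (p ∷ q ∷ v ∷ [])) uv≡z)

open import Defs
open import Data.Nat using (ℕ; _%_) renaming (_*_ to _*ℕ_)
open import Data.Nat.Primality using (Prime)
open import Data.Integer using (ℤ; +_; _+_; _-_; _*_; -_)
open import Data.Product using (_×_; ∃-syntax; _,_; proj₁; proj₂)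
open import Relation.Binary.PropositionalEquality using (_≡_; refl)
open import Data.Nat.Primality using (prime⇒nonZero)
open import Data.Nat.Divisibility using (divides; ∣-refl)
open import Function using (case_of_)
open import Relation.Nullary using (¬_)
open Congruence using (_≡_[mod_])
open Legendre using (LegendreIsOne⇒residue; LegendreIsMinusOne⇒non-residue)
open FundamentalUnits using (fundamental-unit⇒solution; sqrt-2ε-in-√m,√n; sqrt-2ε-in-1,√n)

lemma4p1 : (p q : ℕ) → Prime p → Prime q → p % 4 ≡ 1 → q % 4 ≡ 3 →
           LegendreIsMinusOne (+ 2) p → LegendreIsOne (+ 2) q →
           LegendreIsMinusOne (+ p) q →
           ((a b : ℤ) → IsFundamentalUnit (p *ℕ q) a b →
              IsSquareℕ (+ p * (a - + 1)) ×
              ∃[ b₁ ] ∃[ b₂ ] (SqrtTwoEps p q a b b₁ b₂ ×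
                + 2 ≡ - (+ p * sq b₁) + + q * sq b₂))
           ×
           ((x y : ℤ) → IsFundamentalUnit (2 *ℕ p *ℕ q) x y →
              IsSquareℕ (+ (2 *ℕ p) * (x - + 1)) ×
              ∃[ y₁ ] ∃[ y₂ ] (SqrtTwoEps (2 *ℕ p) q x y y₁ y₂ ×
                + 2 ≡ - (+ (2 *ℕ p) * sq y₁) + + q * sq y₂))
           ×
           ((c d : ℤ) → IsFundamentalUnit (2 *ℕ q) c d →
              IsSquareℕ (c + + 1) ×
              ∃[ d₁ ] ∃[ d₂ ] (SqrtTwoEps 1 (2 *ℕ q) c d d₁ d₂ ×
                + 2 ≡ sq d₁ - + (2 *ℕ q) * sq d₂))
           ×
           ((c' d' : ℤ) → IsFundamentalUnit q c' d' →
              IsSquareℕ (c' + + 1) ×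
              ∃[ d₁' ] ∃[ d₂' ] (SqrtTwoEps 1 q c' d' d₁' d₂' ×
                + 2 ≡ sq d₁' - + q * sq d₂'))
lemma4p1 p q p-prime q-prime p≡1[mod4] q≡3[mod4] 2/p≡-1 2/q≡1 p/q≡-1 =
  (λ a b ε → case fundamental-unit⇒solution {p *ℕ q} {a} {b} ε (q∣D⇒norm≢-1 (divides p refl)) of λ where
     (_ , _ , refl , refl , norm , not-square) →
       sqrt-2ε-in-√m,√n (sqrt2ε[pq] p-prime p≡1[mod4] 2-non-residue p-non-residue norm not-square)) ,
  (λ x y ε → case fundamental-unit⇒solution {2 *ℕ p *ℕ q} {x} {y} ε (q∣D⇒norm≢-1 (divides (2 *ℕ p) refl)) of λ where
     (_ , _ , refl , refl , norm , not-square) →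
       sqrt-2ε-in-√m,√n (sqrt2ε[2pq] p-prime p≡1[mod4] 2-non-residue p-non-residue norm not-square)) ,
  (λ c d ε → case fundamental-unit⇒solution {2 *ℕ q} {c} {d} ε (q∣D⇒norm≢-1 (divides 2 refl)) of λ where
     (_ , _ , refl , refl , norm , not-square) → sqrt-2ε-in-1,√n (sqrt2ε[2q] norm not-square)) ,
  (λ c d ε → case fundamental-unit⇒solution {q} {c} {d} ε (q∣D⇒norm≢-1 ∣-refl) of λ where
     (_ , _ , refl , refl , norm , not-square) → sqrt-2ε-in-1,√n (sqrt2ε[q] norm not-square))
  where
  instance
    _ = prime⇒nonZero p-prime
    _ = prime⇒nonZero q-prime
  w : ℕ
  w = proj₁ (LegendreIsOne⇒residue 2/q≡1)
  w²≡2 : w *ℕ w ≡ 2 [mod q ]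
  w²≡2 = proj₂ (LegendreIsOne⇒residue 2/q≡1)
  2-non-residue : ∀ x → ¬ x *ℕ x ≡ 2 [mod p ]
  2-non-residue = LegendreIsMinusOne⇒non-residue 2/p≡-1
  p-non-residue : ∀ x → ¬ x *ℕ x ≡ p [mod q ]
  p-non-residue = LegendreIsMinusOne⇒non-residue p/q≡-1
  open QuadraticResidues.PrimeThreeModFour q-prime q≡3[mod4] w w²≡2 using (q∣D⇒norm≢-1)
  open Decompositions.SqrtTwoEpsilon q-prime q≡3[mod4] w w²≡2
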